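{- Let $r,s$ be positive integers and let $(P,Q)$ with the associated template be one of Cases (1)–(4) below. Set $\theta=1/2$ in Cases (1),(2),(3) and $\theta=r/s$ in Case (4). Let $p$ be a prime with $p\equiv1\pmod s$, $n=p^2$, and let $t:\{0,1\}^n\to\{0,1\}$ be a doubly cyclic polymorphism of the template, with transpose $t^\sigma$. Then for every integer $0\le k<2\theta n$, $$t^\sigma\langle k\rangle=\begin{cases}t^\sigma\langle 0\rangle & \text{if } k<\theta n,\\ 1-t^\sigma\langle 0\rangle & \text{if } k>\theta n.\end{cases}$$
   Context: Relations: $r\text{ -in- }s=\{x\in\{0,1\}^s:\sum x_i=r\}$, $\leq\! r\text{ -in- }s=\{x:\sum x_i\le r\}$, $\text{not-all-equal- }s=\{x\in\{0,1\}^s:\sum x_i\notin\{0,s\}\}$. Cases: (1) $P=r\text{ -in- }s$, $Q=\leq\!(2r-1)\text{ -in- }s$, $1<r<s/2$, together with the disequality pair; (2) $P=\leq\! r\text{ -in- }s$, $Q=\leq\!(2r-1)\text{ -in- }s$, $s$ even, $1<r=s/2$, with disequality pair; (3) $P=r\text{ -in- }s$, $Q=\leq\!(2r-1)\text{ -in- }s$, $s$ even, $1<r=s/2$, $r$ even, with disequality pair; (4) $P=r\text{ -in- }s$, $Q=\text{not-all-equal- }s$, $s>r$, $s>2$, $r\le s/2$, $r$ even or $s$ odd, no disequality pair. A function $f:\{0,1\}^N\to\{0,1\}$ is a polymorphism of the template if whenever $u_1,\dots,u_N\in P$ the tuple $(f(u_1(j),\dots,u_N(j)))_{j=1}^s$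 lies in $Q$, and, in Cases (1)–(3), additionally $f(1-x_1,\dots,1-x_N)=1-f(x_1,\dots,x_N)$ for all $x$. Doubly cyclic: writing the $p^2$ arguments as $p$ consecutive blocks $\mathbf x_1,\dots,\mathbf x_p$ of length $p$, $t(\mathbf x_1,\dots,\mathbf x_p)=t(\mathbf y_1,\dots,\mathbf y_p)$ whenever each $\mathbf y_i$ is a cyclic shift of $\mathbf x_i$, and $t(\mathbf x_1,\dots,\mathbf x_p)=t(\mathbf x_2,\dots,\mathbf x_p,\mathbf x_1)$. Transpose: $t^\sigma(y_1,\dots,y_{p^2})=t(z_1,\dots,z_{p^2})$ with $z_{(j-1)p+i}=y_{(i-1)p+j}$ for $i,j\in[p]$. $\langle k\rangle$ is the $n$-tuple of $k$ ones followed by $n-k$ zeros. -}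

module Defs where

open import Data.Nat using (ℕ; zero; suc; _+_; _*_; _∸_; _≤_; _<_; _<ᵇ_)
open import Data.Nat.DivMod using (_%_; m%n<n)
open import Data.Nat.Divisibility using (_∣_)
open import Data.Bool using (Bool; true; false; not; if_then_else_)
open import Data.Fin using (Fin; toℕ; fromℕ<; combine; remQuot)
open import Data.Product using (_×_; _,_)
open import Data.Sum using (_⊎_)
open import Data.Empty using (⊥)
open import Data.Unit using (⊤)
open import Relation.Nullary using (¬_)
open import Relation.Binary.PropositionalEquality using (_≡_; _≢_)
open import Function using (_∘_)

-- Boolean tuples of length s are functions Fin s → Bool (true = 1).
-- number of ones in a tuple
ones : ∀ {s} → (Fin s → Bool) → ℕ
ones {zero}  x = 0
ones {suc s} x = (if x Fin.zero then 1 else 0) + ones (x ∘ Fin.suc)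
  where import Data.Fin as Fin

exactly : (r s : ℕ) → (Fin s → Bool) → Set
exactly r s x = ones x ≡ r

atMost : (r s : ℕ) → (Fin s → Bool) → Set
atMost r s x = ones x ≤ r

nae : (s : ℕ) → (Fin s → Bool) → Set
nae s x = (ones x ≢ 0) × (ones x ≢ s)

data Case : Set where
  case1 case2 case3 case4 : Case

CaseCond : Case → ℕ → ℕ → Set
CaseCond case1 r s = (1 < r) × (2 * r < s)
CaseCond case2 r s = (2 ∣ s) × (1 < r) × (2 * r ≡ s)
CaseCond case3 r s = (2 ∣ s) × (1 < r) × (2 * r ≡ s) × (2 ∣ r)
CaseCond case4 r s = (r < s) × (2 < s) × (2 * r ≤ s) × ((2 ∣ r) ⊎ ¬ (2 ∣ s))

P : Case → (r s : ℕ) → (Fin s → Bool) → Set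
P case1 r s = exactly r s
P case2 r s = atMost r s
P case3 r s = exactly r s
P case4 r s = exactly r s

Q : Case → (r s : ℕ) → (Fin s → Bool) → Set
Q case1 r s = atMost (2 * r ∸ 1) s
Q case2 r s = atMost (2 * r ∸ 1) s
Q case3 r s = atMost (2 * r ∸ 1) s
Q case4 r s = nae s

-- whether the template contains the disequality pair
HasDiseq : Case → Set
HasDiseq case4 = ⊥
HasDiseq _     = ⊤

IsPolymorphism : Case → (r s N : ℕ) → ((Fin N → Bool) → Bool) → Set
IsPolymorphism c r s N f =
  ((u : Fin N → Fin s → Bool) → (∀ i → P c r s (u i)) →
     Q c r s (λ j → f (λ i → u i j)))
  × (HasDiseq c → ∀ (x : Fin N → Bool) → f (not ∘ x) ≡ not (f x))

rot : ∀ {A : Set} {m : ℕ} → ℕ → (Fin m → A) → Fin m → A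
rot {m = zero}  c x j = x j
rot {m = suc m} c x j = x (fromℕ< (m%n<n (toℕ j + c) (suc m)))

-- block decomposition of an argument tuple of length p*p:
-- block i, position j (0-based) is the index combine i j = i*p + j
block : ∀ {A : Set} (p : ℕ) → (Fin (p * p) → A) → Fin p → Fin p → A
block p x i j = x (combine i j)

unblock : ∀ {A : Set} (p : ℕ) → (Fin p → Fin p → A) → Fin (p * p) → A
unblock p b idx with remQuot p idx
... | i , j = b i j

DoublyCyclic : (p : ℕ) → ((Fin (p * p) → Bool) → Bool) → Set
DoublyCyclic p t =
  (∀ (x : Fin (p * p) → Bool) (c : Fin p → ℕ) →
     t x ≡ t (unblock p (λ i → rot (c i) (block p x i))))
  × (∀ (x : Fin (p * p) → Bool) → t x ≡ t (unblock p (rot 1 (block p x))))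

-- transpose: t^σ(y) = t(z) with z_{(j-1)p+i} = y_{(i-1)p+j}
transpose : (p : ℕ) → ((Fin (p * p) → Bool) → Bool) → (Fin (p * p) → Bool) → Bool
transpose p t y = t (λ idx → z idx)
  where
  z : Fin (p * p) → Bool
  z idx with remQuot p idx
  ... | j , i = y (combine i j)

⟨_⟩ : ∀ {n} → ℕ → Fin n → Bool
⟨ k ⟩ i = toℕ i <ᵇ k

θnum : Case → ℕ → ℕ
θnum case4 r = r
θnum _     r = 1

θden : Case → ℕ → ℕ
θden case4 s = s
θden _     s = 2

module Submission where

-- Write G k = t^σ⟨k⟩. Rotating the blocks of the transposed ⟨k⟩, and rotating inside each block,
-- does not change the value of t, and the resulting words are, block by block, cyclic intervals
-- whose complements are again of this form (with value not (G k), using self-duality). Stacking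
-- the intervals of s such words in every block covers each coordinate equally often, so any s
-- weights (or co-weights) summing to r p² yield s tuples in P whose columns t sends to the s
-- corresponding values of G; hence those values satisfy Q. What remains is a statement about
-- G : ℕ → Bool alone. In Cases 1–3, with p² = 2M + 1, pairing the weights w and p² − w and
-- inducting outwards from M shows that G is constant on [0, M] and takes the other value on
-- [M + 1, 2M]. In Case 4, with p² = s w + 1 and m = r w, the same kind of induction outwards
-- from m shows that G is constant on [0, m] and takes the other value on [m + 1, 2m].

open import Defs
open import Data.Nat
open import Data.Nat.Properties
open import Data.Nat.DivMod
open import Data.Nat.Tactic.RingSolver using (solve-∀)
open import Data.Nat.ListAction using (sum)
open import Data.Nat.ListAction.Properties using (sum-++)
open import Data.Nat.Primality using (Prime; prime⇒nonTrivial; prime⇒¬composite)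
open import Data.Nat.Divisibility using (_∣_; divides)
open import Data.Nat.Divisibility.Core using (hasNonTrivialDivisor)
open import Data.Bool using (Bool; true; false; not; if_then_else_; T)
open import Data.Bool.Properties using (¬-not; not-involutive)
open import Data.Fin using (Fin; toℕ; fromℕ<; combine; remQuot)
import Data.Fin as Fin
open import Data.Fin.Properties using (toℕ<n; toℕ-injective; toℕ-fromℕ<; remQuot-combine; toℕ-combine; combine-remQuot)
open import Data.List using (List; []; _∷_; _++_; map; length; lookup; replicate)
open import Data.List.Properties using (length-++; length-replicate; map-++; map-replicate)
open import Data.List.Relation.Unary.All using (All; []; _∷_)
open import Data.List.Relation.Unary.All.Properties using (++⁺; replicate⁺)
open import Data.Product using (_×_; _,_; proj₁; proj₂; Σ-syntax; ∃)
open import Data.Sum using (_⊎_; inj₁; inj₂)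
open import Data.Empty using (⊥; ⊥-elim)
open import Data.Unit using (⊤; tt)
open import Function using (_∘_)
open import Relation.Binary using (tri<; tri≈; tri>)
open import Relation.Nullary using (¬_; Dec; yes; no)
open import Relation.Binary.PropositionalEquality

ind : Bool → ℕ
ind b = if b then 1 else 0

ind≤1 : ∀ b → ind b ≤ 1
ind≤1 true  = ≤-refl
ind≤1 false = z≤n

+-regroup : ∀ a b c d → a + (b + c) + d ≡ a + b + (c + d)
+-regroup = solve-∀

T-ext : ∀ {a b : Bool} → (T a → T b) → (T b → T a) → a ≡ b
T-ext {false} {false} _ _ = refl
T-ext {false} {true}  _ g = ⊥-elim (g tt)
T-ext {true}  {false} f _ = ⊥-elim (f tt)
T-ext {true}  {true}  _ _ = refl

<ᵇ-true : ∀ {m n} → m < n → (m <ᵇ n) ≡ true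
<ᵇ-true {m} {n} m<n = T-ext (λ _ → tt) (λ _ → <⇒<ᵇ m<n)

<ᵇ-false : ∀ {m n} → ¬ (m < n) → (m <ᵇ n) ≡ false
<ᵇ-false {m} {n} m≮n = T-ext (λ x → m≮n (<ᵇ⇒< m n x)) (λ ())

ind-<ᵇ-suc : ∀ d h → ind (d <ᵇ suc h) ≡ ind (d <ᵇ h) + ind (d ≡ᵇ h)
ind-<ᵇ-suc zero          zero    = refl
ind-<ᵇ-suc zero          (suc h) = refl
ind-<ᵇ-suc (suc zero)    zero    = refl
ind-<ᵇ-suc (suc (suc d)) zero    = refl
ind-<ᵇ-suc (suc d)       (suc h) = ind-<ᵇ-suc d h

-- Residues modulo p

module Residues (q : ℕ) where

  p : ℕ
  p = suc q

  %-absorbˡ : ∀ m n → (m % p + n) % p ≡ (m + n) % p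
  %-absorbˡ m n = begin
    (m % p + n) % p             ≡⟨ %-distribˡ-+ (m % p) n p ⟩
    (m % p % p + n % p) % p     ≡⟨ cong (λ w → (w + n % p) % p) (m%n%n≡m%n m p) ⟩
    (m % p + n % p) % p         ≡⟨ %-distribˡ-+ m n p ⟨
    (m + n) % p                 ∎
    where open ≡-Reasoning

  %-absorbʳ : ∀ m n → (m + n % p) % p ≡ (m + n) % p
  %-absorbʳ m n = begin
    (m + n % p) % p   ≡⟨ cong (_% p) (+-comm m (n % p)) ⟩
    (n % p + m) % p   ≡⟨ %-absorbˡ n m ⟩
    (n + m) % p       ≡⟨ cong (_% p) (+-comm n m) ⟩
    (m + n) % p       ∎
    where open ≡-Reasoning

  +-complement≡*p : ∀ H → H + (p ∸ H % p) ≡ suc (H / p) * p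
  +-complement≡*p H = begin
    H + (p ∸ H % p)                   ≡⟨ cong (_+ (p ∸ H % p)) (m≡m%n+[m/n]*n H p) ⟩
    H % p + H / p * p + (p ∸ H % p)   ≡⟨ rearrange (H % p) (H / p * p) (p ∸ H % p) ⟩
    H / p * p + (H % p + (p ∸ H % p)) ≡⟨ cong (H / p * p +_) (m+[n∸m]≡n (m%n≤n H p)) ⟩
    H / p * p + p                     ≡⟨ +-comm (H / p * p) p ⟩
    suc (H / p) * p                   ∎
    where
    open ≡-Reasoning
    rearrange : ∀ a b c → a + b + c ≡ b + (a + c)
    rearrange = solve-∀

  -- the unique d < p with (H + d) % p ≡ x
  offset : ℕ → ℕ → ℕ
  offset H x = (x + (p ∸ H % p)) % p

  +-offset : ∀ H x → x < p → (H + offset H x) % p ≡ x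
  +-offset H x x<p = begin
    (H + offset H x) % p          ≡⟨ %-absorbʳ H (x + (p ∸ H % p)) ⟩
    (H + (x + (p ∸ H % p))) % p   ≡⟨ cong (_% p) (x+[H+c]) ⟩
    (x + suc (H / p) * p) % p     ≡⟨ [m+kn]%n≡m%n x (suc (H / p)) p ⟩
    x % p                         ≡⟨ m<n⇒m%n≡m x<p ⟩
    x                             ∎
    where
    open ≡-Reasoning
    x+[H+c] : H + (x + (p ∸ H % p)) ≡ x + suc (H / p) * p
    x+[H+c] = trans (left-comm H x (p ∸ H % p)) (cong (x +_) (+-complement≡*p H))
      where
      left-comm : ∀ a b c → a + (b + c) ≡ b + (a + c)
      left-comm = solve-∀

  offset-unique : ∀ H d → d < p → offset H ((H + d) % p) ≡ d
  offset-unique H d d<p = begin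
    ((H + d) % p + (p ∸ H % p)) % p   ≡⟨ %-absorbˡ (H + d) (p ∸ H % p) ⟩
    (H + d + (p ∸ H % p)) % p         ≡⟨ cong (_% p) d+[H+c] ⟩
    (d + suc (H / p) * p) % p         ≡⟨ [m+kn]%n≡m%n d (suc (H / p)) p ⟩
    d % p                             ≡⟨ m<n⇒m%n≡m d<p ⟩
    d                                 ∎
    where
    open ≡-Reasoning
    d+[H+c] : H + d + (p ∸ H % p) ≡ d + suc (H / p) * p
    d+[H+c] = trans (swap H d (p ∸ H % p)) (cong (d +_) (+-complement≡*p H))
      where
      swap : ∀ a b c → a + b + c ≡ b + (a + c)
      swap = solve-∀

  residueCount : ℕ → ℕ → ℕ
  residueCount x zero    = 0
  residueCount x (suc P) = residueCount x P + ind (P % p ≡ᵇ x)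

  offset≡ᵇ : ∀ H x h → x < p → h < p → (offset H x ≡ᵇ h) ≡ ((H + h) % p ≡ᵇ x)
  offset≡ᵇ H x h x<p h<p = T-ext
    (λ o≡h → ≡⇒≡ᵇ ((H + h) % p) x (trans (cong (λ d → (H + d) % p) (sym (≡ᵇ⇒≡ (offset H x) h o≡h))) (+-offset H x x<p)))
    (λ Hh≡x → ≡⇒≡ᵇ (offset H x) h (trans (cong (offset H) (sym (≡ᵇ⇒≡ ((H + h) % p) x Hh≡x))) (offset-unique H h h<p)))

  residueCount-window : ∀ x H h → x < p → h ≤ p →
    ind (offset H x <ᵇ h) + residueCount x H ≡ residueCount x (H + h)
  residueCount-window x H zero x<p h≤p = cong (residueCount x) (sym (+-identityʳ H))
  residueCount-window x H (suc h) x<p h<p = begin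
    ind (D <ᵇ suc h) + residueCount x H
      ≡⟨ cong (_+ residueCount x H) (ind-<ᵇ-suc D h) ⟩
    ind (D <ᵇ h) + ind (D ≡ᵇ h) + residueCount x H
      ≡⟨ swap (ind (D <ᵇ h)) (ind (D ≡ᵇ h)) (residueCount x H) ⟩
    ind (D <ᵇ h) + residueCount x H + ind (D ≡ᵇ h)
      ≡⟨ cong₂ _+_ (residueCount-window x H h x<p (<⇒≤ h<p)) (cong ind (offset≡ᵇ H x h x<p h<p)) ⟩
    residueCount x (suc (H + h))
      ≡⟨ cong (residueCount x) (+-suc H h) ⟨
    residueCount x (H + suc h) ∎
    where
    open ≡-Reasoning
    D = offset H x
    swap : ∀ a b c → a + b + c ≡ a + c + b
    swap = solve-∀

  residueCount-+p : ∀ x H → x < p → residueCount x (H + p) ≡ residueCount x H + 1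
  residueCount-+p x H x<p = begin
    residueCount x (H + p)                       ≡⟨ residueCount-window x H p x<p ≤-refl ⟨
    ind (offset H x <ᵇ p) + residueCount x H     ≡⟨ cong (λ b → ind b + residueCount x H) (<ᵇ-true (m%n<n (x + (p ∸ H % p)) p)) ⟩
    1 + residueCount x H                         ≡⟨ +-comm 1 _ ⟩
    residueCount x H + 1                         ∎
    where open ≡-Reasoning

  residueCount-*p : ∀ x C → x < p → residueCount x (C * p) ≡ C
  residueCount-*p x zero    x<p = refl
  residueCount-*p x (suc C) x<p = begin
    residueCount x (p + C * p)    ≡⟨ cong (residueCount x) (+-comm p (C * p)) ⟩
    residueCount x (C * p + p)    ≡⟨ residueCount-+p x (C * p) x<p ⟩
    residueCount x (C * p) + 1    ≡⟨ cong (_+ 1) (residueCount-*p x C x<p) ⟩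
    C + 1                         ≡⟨ +-comm C 1 ⟩
    suc C                         ∎
    where open ≡-Reasoning

  residueCount-mono : ∀ x {P P'} → P ≤ P' → residueCount x P ≤ residueCount x P'
  residueCount-mono x {P} {P'} P≤P' = subst (λ P″ → residueCount x P ≤ residueCount x P″) (m+[n∸m]≡n P≤P') (grow (P' ∸ P))
    where
    grow : ∀ d → residueCount x P ≤ residueCount x (P + d)
    grow zero    = ≤-reflexive (cong (residueCount x) (sym (+-identityʳ P)))
    grow (suc d) = ≤-trans (grow d) (subst (λ P″ → residueCount x (P + d) ≤ residueCount x P″) (sym (+-suc P d)) (m≤m+n _ _))

  residueCount-≤ : ∀ x {P} C → x < p → P ≤ C * p → residueCount x P ≤ C
  residueCount-≤ x {P} C x<p P≤Cp = subst (residueCount x P ≤_) (residueCount-*p x C x<p) (residueCount-mono x P≤Cp)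

-- Orbit words as cyclic intervals

module Tiles (q : ℕ) where
  open Residues q public

  Word : Set
  Word = Fin (p * p) → Bool

  -- position i of block j
  cell : Fin p → Fin p → Fin (p * p)
  cell = combine {p} {p}

  -- transpose p t ⟨ k ⟩ is t (transposed k) by definition
  transposed : ℕ → Word
  transposed k idx = ⟨ k ⟩ (cell (proj₂ (remQuot {p} p idx)) (proj₁ (remQuot {p} p idx)))

  rotateBlocks : ℕ → Word → Word
  rotateBlocks zero    x = x
  rotateBlocks (suc o) x = unblock p (rot 1 (block p (rotateBlocks o x)))

  rotateWithin : (Fin p → ℕ) → Word → Word
  rotateWithin e x = unblock p (λ j → rot (e j) (block p x j))

  orbitWord : ℕ → ℕ → (Fin p → ℕ) → Word
  orbitWord k o e = rotateWithin e (rotateBlocks o (transposed k))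

  t-orbitWord : ∀ t → DoublyCyclic p t → ∀ k o e → t (transposed k) ≡ t (orbitWord k o e)
  t-orbitWord t (withinBlocks , ofBlocks) k o e = trans (rotations o) (withinBlocks (rotateBlocks o (transposed k)) e)
    where
    rotations : ∀ o → t (transposed k) ≡ t (rotateBlocks o (transposed k))
    rotations zero    = refl
    rotations (suc o) = trans (rotations o) (ofBlocks (rotateBlocks o (transposed k)))

  mod-p : ℕ → Fin p
  mod-p m = fromℕ< (m%n<n m p)

  toℕ-mod-p : ∀ m → toℕ (mod-p m) ≡ m % p
  toℕ-mod-p m = toℕ-fromℕ< (m%n<n m p)

  unblock-cell : ∀ (b : Fin p → Fin p → Bool) j i → unblock p b (cell j i) ≡ b j i
  unblock-cell b j i = cong (λ ji → b (proj₁ ji) (proj₂ ji)) (remQuot-combine {p} {p} j i)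

  rotateBlocks-cell : ∀ o x j i → rotateBlocks o x (cell j i) ≡ x (cell (mod-p (toℕ j + o)) i)
  rotateBlocks-cell zero x j i = cong (λ j' → x (cell j' i)) (toℕ-injective (sym (begin
    toℕ (mod-p (toℕ j + 0))  ≡⟨ toℕ-mod-p (toℕ j + 0) ⟩
    (toℕ j + 0) % p          ≡⟨ cong (_% p) (+-identityʳ (toℕ j)) ⟩
    toℕ j % p                ≡⟨ m<n⇒m%n≡m (toℕ<n j) ⟩
    toℕ j                    ∎)))
    where open ≡-Reasoning
  rotateBlocks-cell (suc o) x j i = begin
    rotateBlocks (suc o) x (cell j i)            ≡⟨ unblock-cell (rot 1 (block p (rotateBlocks o x))) j i ⟩
    rotateBlocks o x (cell (mod-p (toℕ j + 1)) i) ≡⟨ rotateBlocks-cell o x (mod-p (toℕ j + 1)) i ⟩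
    x (cell (mod-p (toℕ (mod-p (toℕ j + 1)) + o)) i) ≡⟨ cong (λ j' → x (cell j' i)) (toℕ-injective shift) ⟩
    x (cell (mod-p (toℕ j + suc o)) i)           ∎
    where
    open ≡-Reasoning
    shift : toℕ (mod-p (toℕ (mod-p (toℕ j + 1)) + o)) ≡ toℕ (mod-p (toℕ j + suc o))
    shift = begin
      toℕ (mod-p (toℕ (mod-p (toℕ j + 1)) + o)) ≡⟨ toℕ-mod-p (toℕ (mod-p (toℕ j + 1)) + o) ⟩
      (toℕ (mod-p (toℕ j + 1)) + o) % p          ≡⟨ cong (λ w → (w + o) % p) (toℕ-mod-p (toℕ j + 1)) ⟩
      ((toℕ j + 1) % p + o) % p                  ≡⟨ %-absorbˡ (toℕ j + 1) o ⟩
      (toℕ j + 1 + o) % p                        ≡⟨ cong (_% p) (+-assoc (toℕ j) 1 o) ⟩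
      (toℕ j + suc o) % p                        ≡⟨ toℕ-mod-p (toℕ j + suc o) ⟨
      toℕ (mod-p (toℕ j + suc o))                ∎

  transposed-cell : ∀ k j i → transposed k (cell j i) ≡ (p * toℕ i + toℕ j <ᵇ k)
  transposed-cell k j i = trans (cong (λ ji → ⟨_⟩ {p * p} k (cell (proj₂ ji) (proj₁ ji))) (remQuot-combine {p} {p} j i))
                                (cong (_<ᵇ k) (toℕ-combine {p} {p} i j))

  orbitWord-cell : ∀ k o e j i →
    orbitWord k o e (cell j i) ≡ (p * ((toℕ i + e j) % p) + (toℕ j + o) % p <ᵇ k)
  orbitWord-cell k o e j i = begin
    orbitWord k o e (cell j i)
      ≡⟨ unblock-cell (λ j → rot (e j) (block p (rotateBlocks o (transposed k)) j)) j i ⟩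
    rotateBlocks o (transposed k) (cell j (mod-p (toℕ i + e j)))
      ≡⟨ rotateBlocks-cell o (transposed k) j (mod-p (toℕ i + e j)) ⟩
    transposed k (cell (mod-p (toℕ j + o)) (mod-p (toℕ i + e j)))
      ≡⟨ transposed-cell k (mod-p (toℕ j + o)) (mod-p (toℕ i + e j)) ⟩
    (p * toℕ (mod-p (toℕ i + e j)) + toℕ (mod-p (toℕ j + o)) <ᵇ k)
      ≡⟨ cong₂ (λ y x → p * y + x <ᵇ k) (toℕ-mod-p (toℕ i + e j)) (toℕ-mod-p (toℕ j + o)) ⟩
    (p * ((toℕ i + e j) % p) + (toℕ j + o) % p <ᵇ k) ∎
    where open ≡-Reasoning

  -- The tile of shape (a , b) is, in block j, the cyclic interval of the given height starting at
  -- position −e j; the height is a + 1 on the b blocks starting at block −o and a elsewhere.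
  height : ℕ → ℕ → ℕ → Fin p → ℕ
  height a b o j = a + ind ((toℕ j + o) % p <ᵇ b)

  tile : ℕ → ℕ → ℕ → (Fin p → ℕ) → Fin p → Fin p → Bool
  tile a b o e j i = (toℕ i + e j) % p <ᵇ height a b o j

  +-<ᵇ-cancelˡ : ∀ m {x y} → (m + x <ᵇ m + y) ≡ (x <ᵇ y)
  +-<ᵇ-cancelˡ zero    = refl
  +-<ᵇ-cancelˡ (suc m) = +-<ᵇ-cancelˡ m

  <ᵇ-+ind : ∀ a c → (a <ᵇ a + ind c) ≡ c
  <ᵇ-+ind zero    true  = refl
  <ᵇ-+ind zero    false = refl
  <ᵇ-+ind (suc a) c     = <ᵇ-+ind a c

  *p+-<ᵇ-*p+ : ∀ a b x y → x < p → b < p → (p * y + x <ᵇ a * p + b) ≡ (y <ᵇ a + ind (x <ᵇ b))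
  *p+-<ᵇ-*p+ a b x y x<p b<p with <-cmp y a
  ... | tri< y<a _ _ = trans (<ᵇ-true lhs) (sym (<ᵇ-true (≤-trans y<a (m≤m+n a _))))
    where
    lhs : p * y + x < a * p + b
    lhs = begin-strict
      p * y + x   <⟨ +-monoʳ-< (p * y) x<p ⟩
      p * y + p   ≡⟨ +-comm (p * y) p ⟩
      p + p * y   ≡⟨ *-suc p y ⟨
      p * suc y   ≤⟨ *-monoʳ-≤ p y<a ⟩
      p * a       ≡⟨ *-comm p a ⟩
      a * p       ≤⟨ m≤m+n (a * p) b ⟩
      a * p + b   ∎
      where open ≤-Reasoning
  ... | tri≈ _ refl _ = begin
      p * y + x <ᵇ y * p + b     ≡⟨ cong (λ m → m + x <ᵇ y * p + b) (*-comm p y) ⟩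
      y * p + x <ᵇ y * p + b     ≡⟨ +-<ᵇ-cancelˡ (y * p) ⟩
      x <ᵇ b                     ≡⟨ <ᵇ-+ind y (x <ᵇ b) ⟨
      y <ᵇ y + ind (x <ᵇ b)      ∎
      where open ≡-Reasoning
  ... | tri> _ _ a<y = trans (<ᵇ-false (<⇒≯ lhs)) (sym (<ᵇ-false (≤⇒≯ rhs)))
    where
    open ≤-Reasoning
    lhs : a * p + b < p * y + x
    lhs = begin-strict
      a * p + b   <⟨ +-monoʳ-< (a * p) b<p ⟩
      a * p + p   ≡⟨ +-comm (a * p) p ⟩
      suc a * p   ≤⟨ *-monoˡ-≤ p a<y ⟩
      y * p       ≡⟨ *-comm y p ⟩
      p * y       ≤⟨ m≤m+n (p * y) x ⟩
      p * y + x   ∎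
    rhs : a + ind (x <ᵇ b) ≤ y
    rhs = begin
      a + ind (x <ᵇ b)  ≤⟨ +-monoʳ-≤ a (ind≤1 (x <ᵇ b)) ⟩
      a + 1             ≡⟨ +-comm a 1 ⟩
      suc a             ≤⟨ a<y ⟩
      y                 ∎

  orbitWord-tile : ∀ k o e j i → orbitWord k o e (cell j i) ≡ tile (k / p) (k % p) o e j i
  orbitWord-tile k o e j i = begin
    orbitWord k o e (cell j i)
      ≡⟨ orbitWord-cell k o e j i ⟩
    (p * y + x <ᵇ k)
      ≡⟨ cong (p * y + x <ᵇ_) (trans (m≡m%n+[m/n]*n k p) (+-comm (k % p) (k / p * p))) ⟩
    (p * y + x <ᵇ k / p * p + k % p)
      ≡⟨ *p+-<ᵇ-*p+ (k / p) (k % p) x y (m%n<n (toℕ j + o) p) (m%n<n k p) ⟩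
    tile (k / p) (k % p) o e j i ∎
    where
    open ≡-Reasoning
    x = (toℕ j + o) % p
    y = (toℕ i + e j) % p

  not-%<ᵇ : ∀ z h → h ≤ p → not (z % p <ᵇ h) ≡ ((z + (p ∸ h)) % p <ᵇ p ∸ h)
  not-%<ᵇ z h h≤p with z % p <? h
  ... | yes w<h = trans (cong not (<ᵇ-true w<h)) (sym (<ᵇ-false (≤⇒≯ (subst (p ∸ h ≤_) (sym shifted) (m≤n+m (p ∸ h) w)))))
    where
    w = z % p
    shifted : (z + (p ∸ h)) % p ≡ w + (p ∸ h)
    shifted = trans (sym (%-absorbˡ z (p ∸ h)))
                    (m<n⇒m%n≡m (subst (w + (p ∸ h) <_) (m+[n∸m]≡n h≤p) (+-monoˡ-< (p ∸ h) w<h)))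
  ... | no w≮h = trans (cong not (<ᵇ-false w≮h)) (sym (<ᵇ-true (subst (_< p ∸ h) (sym shifted) w∸h<p∸h)))
    where
    w = z % p
    h≤w : h ≤ w
    h≤w = ≮⇒≥ w≮h
    w∸h<p∸h : w ∸ h < p ∸ h
    w∸h<p∸h = ∸-monoˡ-< (m%n<n z p) h≤w
    shifted : (z + (p ∸ h)) % p ≡ w ∸ h
    shifted = begin
      (z + (p ∸ h)) % p   ≡⟨ %-absorbˡ z (p ∸ h) ⟨
      (w + (p ∸ h)) % p   ≡⟨ cong (_% p) (trans (sym (+-∸-assoc w h≤p)) (trans (cong (_∸ h) (+-comm w p)) (+-∸-assoc p h≤w))) ⟩
      (p + (w ∸ h)) % p   ≡⟨ cong (_% p) (+-comm p (w ∸ h)) ⟩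
      (w ∸ h + p) % p     ≡⟨ [m+n]%n≡m%n (w ∸ h) p ⟩
      (w ∸ h) % p         ≡⟨ m<n⇒m%n≡m (<-≤-trans w∸h<p∸h (m∸n≤m p h)) ⟩
      w ∸ h               ∎
      where open ≡-Reasoning

  -- the shape of the complement of a tile of shape (a , b)
  coQuot : ℕ → ℕ → ℕ
  coQuot a zero    = p ∸ a
  coQuot a (suc _) = p ∸ suc a

  coRem : ℕ → ℕ
  coRem zero    = 0
  coRem (suc b) = p ∸ suc b

  coRem≤p : ∀ b → coRem b ≤ p
  coRem≤p zero    = z≤n
  coRem≤p (suc b) = m∸n≤m p (suc b)

  quot<p : ∀ a b → a * p + suc b ≤ p * p → a < p
  quot<p a b le = *-cancelʳ-< p a p (<-≤-trans (m<m+n (a * p) {suc b} z<s) (subst (a * p + suc b ≤_) (*-comm p p) le))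

  height≤p : ∀ a b o j → a * p + b ≤ p * p → height a b o j ≤ p
  height≤p a zero o j le =
    subst (_≤ p) (sym (+-identityʳ a)) (*-cancelʳ-≤ a p p (subst₂ _≤_ (+-identityʳ (a * p)) (*-comm p p) le))
  height≤p a (suc b) o j le =
    ≤-trans (+-monoʳ-≤ a (ind≤1 _)) (subst (_≤ p) (+-comm 1 a) (quot<p a b le))

  p∸height≡height : ∀ a b o j → a * p + b ≤ p * p → b < p →
    p ∸ height a b (o + b) j ≡ height (coQuot a b) (coRem b) o j
  p∸height≡height a zero o j le b<p = trans (cong (p ∸_) (+-identityʳ a)) (sym (+-identityʳ (p ∸ a)))
  p∸height≡height a (suc b) o j le b<p = begin
    p ∸ (a + ind X)                  ≡⟨ p∸[a+ind] X ⟩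
    p ∸ suc a + ind (not X)          ≡⟨ cong (λ c → p ∸ suc a + ind c) notX≡Y ⟩
    p ∸ suc a + ind Y                ∎
    where
    open ≡-Reasoning
    X = (toℕ j + (o + suc b)) % p <ᵇ suc b
    Y = (toℕ j + o) % p <ᵇ p ∸ suc b
    p∸[a+ind] : ∀ c → p ∸ (a + ind c) ≡ p ∸ suc a + ind (not c)
    p∸[a+ind] true  = trans (cong (p ∸_) (+-comm a 1)) (sym (+-identityʳ _))
    p∸[a+ind] false = trans (cong (p ∸_) (+-identityʳ a))
                            (trans (+-∸-assoc 1 (quot<p a b le)) (+-comm 1 (p ∸ suc a)))
    wraps : toℕ j + (o + suc b) + (p ∸ suc b) ≡ toℕ j + o + p
    wraps = trans (+-regroup (toℕ j) o (suc b) (p ∸ suc b)) (cong (toℕ j + o +_) (m+[n∸m]≡n (<⇒≤ b<p)))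
    notX≡Y : not X ≡ Y
    notX≡Y = begin
      not X                                                   ≡⟨ not-%<ᵇ (toℕ j + (o + suc b)) (suc b) (<⇒≤ b<p) ⟩
      (toℕ j + (o + suc b) + (p ∸ suc b)) % p <ᵇ p ∸ suc b   ≡⟨ cong (λ z → z % p <ᵇ p ∸ suc b) wraps ⟩
      (toℕ j + o + p) % p <ᵇ p ∸ suc b                       ≡⟨ cong (_<ᵇ p ∸ suc b) ([m+n]%n≡m%n (toℕ j + o) p) ⟩
      Y                                                       ∎

  coStart : ℕ → ℕ → (Fin p → ℕ) → Fin p → ℕ
  coStart k o e j = e j + height (k / p) (k % p) (o + k % p) j

  k≡quot*p+rem : ∀ k → k ≡ k / p * p + k % p
  k≡quot*p+rem k = trans (m≡m%n+[m/n]*n k p) (+-comm (k % p) (k / p * p))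

  not-orbitWord-tile : ∀ k o e j i → k ≤ p * p →
    not (orbitWord k (o + k % p) (coStart k o e) (cell j i)) ≡ tile (coQuot (k / p) (k % p)) (coRem (k % p)) o e j i
  not-orbitWord-tile k o e j i k≤pp = begin
    not (orbitWord k (o + b) (coStart k o e) (cell j i))
      ≡⟨ cong not (orbitWord-tile k (o + b) (coStart k o e) j i) ⟩
    not ((toℕ i + (e j + h)) % p <ᵇ h)
      ≡⟨ not-%<ᵇ (toℕ i + (e j + h)) h h≤p ⟩
    (toℕ i + (e j + h) + (p ∸ h)) % p <ᵇ p ∸ h
      ≡⟨ cong₂ _<ᵇ_ wraps (p∸height≡height a b o j ap+b≤pp (m%n<n k p)) ⟩
    tile (coQuot a b) (coRem b) o e j i ∎
    where
    open ≡-Reasoning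
    a = k / p
    b = k % p
    h = height a b (o + b) j
    ap+b≤pp : a * p + b ≤ p * p
    ap+b≤pp = subst (_≤ p * p) (k≡quot*p+rem k) k≤pp
    h≤p : h ≤ p
    h≤p = height≤p a b (o + b) j ap+b≤pp
    wraps : (toℕ i + (e j + h) + (p ∸ h)) % p ≡ (toℕ i + e j) % p
    wraps = trans (cong (_% p) (trans (+-regroup (toℕ i) (e j) h (p ∸ h)) (cong (toℕ i + e j +_) (m+[n∸m]≡n h≤p))))
                  ([m+n]%n≡m%n (toℕ i + e j) p)

  p*p∸k≡coQuot*p+coRem : ∀ k → k ≤ p * p → p * p ∸ k ≡ coQuot (k / p) (k % p) * p + coRem (k % p)
  p*p∸k≡coQuot*p+coRem k k≤pp = go (k / p) (k % p) (k≡quot*p+rem k) (m%n<n k p)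
    where
    go : ∀ a b → k ≡ a * p + b → b < p → p * p ∸ k ≡ coQuot a b * p + coRem b
    go a zero k≡ap b<p = begin
      p * p ∸ k        ≡⟨ cong (p * p ∸_) (trans k≡ap (+-identityʳ (a * p))) ⟩
      p * p ∸ a * p    ≡⟨ *-distribʳ-∸ p p a ⟨
      (p ∸ a) * p      ≡⟨ +-identityʳ _ ⟨
      (p ∸ a) * p + 0  ∎
      where open ≡-Reasoning
    go a (suc b) k≡ap b<p = +-cancelʳ-≡ k _ _ (trans (m∸n+n≡m k≤pp) (sym sums))
      where
      a<p = quot<p a b (subst (_≤ p * p) k≡ap k≤pp)
      sums : (p ∸ suc a) * p + (p ∸ suc b) + k ≡ p * p
      sums = begin
        (p ∸ suc a) * p + (p ∸ suc b) + k
          ≡⟨ cong ((p ∸ suc a) * p + (p ∸ suc b) +_) k≡ap ⟩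
        (p ∸ suc a) * p + (p ∸ suc b) + (a * p + suc b)
          ≡⟨ regroup (p ∸ suc a) p (p ∸ suc b) a (suc b) ⟩
        (a + (p ∸ suc a)) * p + (suc b + (p ∸ suc b))
          ≡⟨ cong ((a + (p ∸ suc a)) * p +_) (m+[n∸m]≡n (<⇒≤ b<p)) ⟩
        (a + (p ∸ suc a)) * p + p
          ≡⟨ +-comm ((a + (p ∸ suc a)) * p) p ⟩
        suc (a + (p ∸ suc a)) * p
          ≡⟨ cong (_* p) (m+[n∸m]≡n a<p) ⟩
        p * p ∎
        where
        open ≡-Reasoning
        regroup : ∀ d p e a b → d * p + e + (a * p + b) ≡ (a + d) * p + (b + e)
        regroup = solve-∀

-- Stacking orbit words

-- orbit k stands for the orbit of the transposed ⟨ k ⟩, coOrbit k for its pointwise negation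
data Row : Set where
  orbit coOrbit : ℕ → Row

level : Row → ℕ
level (orbit k)   = k
level (coOrbit k) = k

value : (ℕ → Bool) → Row → Bool
value G (orbit k)   = G k
value G (coOrbit k) = not (G k)

valueCount : (ℕ → Bool) → List Row → ℕ
valueCount G ρs = sum (map (ind ∘ value G) ρs)

module Weights (n : ℕ) where

  weight : Row → ℕ
  weight (orbit k)   = k
  weight (coOrbit k) = n ∸ k

  totalWeight : List Row → ℕ
  totalWeight ρs = sum (map weight ρs)

  Bounded : Row → Set
  Bounded ρ = level ρ ≤ n

ones-cong : ∀ {m} {f g : Fin m → Bool} → (∀ l → f l ≡ g l) → ones f ≡ ones g
ones-cong {zero}  f≗g = refl
ones-cong {suc m} f≗g = cong₂ (λ b c → ind b + c) (f≗g Fin.zero) (ones-cong (f≗g ∘ Fin.suc))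

ones-lookup : ∀ G (ρs : List Row) → ones (value G ∘ lookup ρs) ≡ valueCount G ρs
ones-lookup G []       = refl
ones-lookup G (ρ ∷ ρs) = cong (ind (value G ρ) +_) (ones-lookup G ρs)

SelfDual : ∀ {N} → ((Fin N → Bool) → Bool) → Set
SelfDual t = ∀ x → t (not ∘ x) ≡ not (t x)

Realizable : ∀ {N} → ((Fin N → Bool) → Bool) → Row → Set
Realizable t (orbit _)   = ⊤
Realizable t (coOrbit _) = SelfDual t

module Tiling (q : ℕ) where
  open Tiles q public
  open Weights (p * p) public

  shapeQuot : Row → ℕ
  shapeQuot (orbit k)   = k / p
  shapeQuot (coOrbit k) = coQuot (k / p) (k % p)

  shapeRem : Row → ℕ
  shapeRem (orbit k)   = k % p
  shapeRem (coOrbit k) = coRem (k % p)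

  shapeRem≤p : ∀ ρ → shapeRem ρ ≤ p
  shapeRem≤p (orbit k)   = <⇒≤ (m%n<n k p)
  shapeRem≤p (coOrbit k) = coRem≤p (k % p)

  weight≡shape : ∀ ρ → Bounded ρ → weight ρ ≡ shapeQuot ρ * p + shapeRem ρ
  weight≡shape (orbit k)   _    = k≡quot*p+rem k
  weight≡shape (coOrbit k) k≤pp = p*p∸k≡coQuot*p+coRem k k≤pp

  word : Row → ℕ → (Fin p → ℕ) → Word
  word (orbit k)   o e = orbitWord k o e
  word (coOrbit k) o e = not ∘ orbitWord k (o + k % p) (coStart k o e)

  word-tile : ∀ ρ o e j i → Bounded ρ → word ρ o e (cell j i) ≡ tile (shapeQuot ρ) (shapeRem ρ) o e j i
  word-tile (orbit k)   o e j i _    = orbitWord-tile k o e j i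
  word-tile (coOrbit k) o e j i k≤pp = not-orbitWord-tile k o e j i k≤pp

  t-word : ∀ t → DoublyCyclic p t → ∀ ρ o e → Realizable t ρ → t (word ρ o e) ≡ value (λ k → transpose p t ⟨ k ⟩) ρ
  t-word t cyclic (orbit k)   o e _        = sym (t-orbitWord t cyclic k o e)
  t-word t cyclic (coOrbit k) o e selfDual =
    trans (selfDual (orbitWord k (o + k % p) (coStart k o e))) (cong not (sym (t-orbitWord t cyclic k (o + k % p) (coStart k o e))))

  -- height of ρ in block j, when the rows stacked below it have total remainder b
  columnHeight : Row → ℕ → Fin p → ℕ
  columnHeight ρ b = height (shapeQuot ρ) (shapeRem ρ) (p ∸ b % p)

  columnHeight≤p : ∀ ρ b j → Bounded ρ → columnHeight ρ b j ≤ p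
  columnHeight≤p ρ b j bounded =
    height≤p (shapeQuot ρ) (shapeRem ρ) (p ∸ b % p) j (subst (_≤ p * p) (weight≡shape ρ bounded) (weight≤ ρ bounded))
    where
    weight≤ : ∀ ρ → Bounded ρ → weight ρ ≤ p * p
    weight≤ (orbit k)   k≤pp = k≤pp
    weight≤ (coOrbit k) _    = m∸n≤m (p * p) k

  -- b and H j are the total remainder and the height in block j of the rows already placed;
  -- the next row starts where they end.
  stack : (ρs : List Row) → ℕ → (Fin p → ℕ) → Fin (length ρs) → Word
  stack (ρ ∷ ρs) b H Fin.zero    = word ρ (p ∸ b % p) (λ j → p ∸ H j % p)
  stack (ρ ∷ ρs) b H (Fin.suc l) = stack ρs (b + shapeRem ρ) (λ j → H j + columnHeight ρ b j) l

  stackHeight : List Row → ℕ → Fin p → ℕ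
  stackHeight []       b j = 0
  stackHeight (ρ ∷ ρs) b j = columnHeight ρ b j + stackHeight ρs (b + shapeRem ρ) j

  totalQuot : List Row → ℕ
  totalQuot ρs = sum (map shapeQuot ρs)

  totalRem : List Row → ℕ
  totalRem ρs = sum (map shapeRem ρs)

  stack-coverage : ∀ ρs b H j i → All Bounded ρs →
    ones (λ l → stack ρs b H l (cell j i)) + residueCount (toℕ i) (H j) ≡ residueCount (toℕ i) (H j + stackHeight ρs b j)
  stack-coverage []       b H j i []                = cong (residueCount (toℕ i)) (sym (+-identityʳ (H j)))
  stack-coverage (ρ ∷ ρs) b H j i (bounded ∷ allBounded) = begin
    ind (word ρ o e (cell j i)) + above + residueCount (toℕ i) (H j)
      ≡⟨ swap-+ (ind (word ρ o e (cell j i))) above _ ⟩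
    above + (ind (word ρ o e (cell j i)) + residueCount (toℕ i) (H j))
      ≡⟨ cong (λ c → above + (ind c + residueCount (toℕ i) (H j))) (word-tile ρ o e j i bounded) ⟩
    above + (ind (offset (H j) (toℕ i) <ᵇ columnHeight ρ b j) + residueCount (toℕ i) (H j))
      ≡⟨ cong (above +_) (residueCount-window (toℕ i) (H j) (columnHeight ρ b j) (toℕ<n i) (columnHeight≤p ρ b j bounded)) ⟩
    above + residueCount (toℕ i) (H' j)
      ≡⟨ stack-coverage ρs b' H' j i allBounded ⟩
    residueCount (toℕ i) (H' j + stackHeight ρs b' j)
      ≡⟨ cong (residueCount (toℕ i)) (+-assoc (H j) (columnHeight ρ b j) _) ⟩
    residueCount (toℕ i) (H j + stackHeight (ρ ∷ ρs) b j) ∎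
    where
    open ≡-Reasoning
    o = p ∸ b % p
    e = λ j → p ∸ H j % p
    b' = b + shapeRem ρ
    H' = λ j → H j + columnHeight ρ b j
    above = ones (λ l → stack ρs b' H' l (cell j i))
    swap-+ : ∀ x y z → x + y + z ≡ y + (x + z)
    swap-+ = solve-∀

  stackHeight-residues : ∀ ρs b j →
    stackHeight ρs b j + residueCount (toℕ j) b ≡ totalQuot ρs + residueCount (toℕ j) (b + totalRem ρs)
  stackHeight-residues []       b j = cong (residueCount (toℕ j)) (sym (+-identityʳ b))
  stackHeight-residues (ρ ∷ ρs) b j = begin
    A + ind extra + rest + residueCount (toℕ j) b
      ≡⟨ regroup A (ind extra) rest _ ⟩
    A + (rest + (ind extra + residueCount (toℕ j) b))
      ≡⟨ cong (λ c → A + (rest + c)) (residueCount-window (toℕ j) b B (toℕ<n j) (shapeRem≤p ρ)) ⟩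
    A + (rest + residueCount (toℕ j) (b + B))
      ≡⟨ cong (A +_) (stackHeight-residues ρs (b + B) j) ⟩
    A + (totalQuot ρs + residueCount (toℕ j) (b + B + totalRem ρs))
      ≡⟨ +-assoc A _ _ ⟨
    A + totalQuot ρs + residueCount (toℕ j) (b + B + totalRem ρs)
      ≡⟨ cong (λ c → A + totalQuot ρs + residueCount (toℕ j) c) (+-assoc b B (totalRem ρs)) ⟩
    A + totalQuot ρs + residueCount (toℕ j) (b + (B + totalRem ρs)) ∎
    where
    open ≡-Reasoning
    A = shapeQuot ρ
    B = shapeRem ρ
    extra = offset b (toℕ j) <ᵇ B
    rest = stackHeight ρs (b + B) j
    regroup : ∀ a x r y → a + x + r + y ≡ a + (r + (x + y))
    regroup = solve-∀

  tiling : (ρs : List Row) → Fin (length ρs) → Word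
  tiling ρs = stack ρs 0 (λ _ → 0)

  tiling-coverage : ∀ ρs j i → All Bounded ρs →
    ones (λ l → tiling ρs l (cell j i)) ≡ residueCount (toℕ i) (totalQuot ρs + residueCount (toℕ j) (totalRem ρs))
  tiling-coverage ρs j i allBounded = begin
    ones (λ l → tiling ρs l (cell j i))
      ≡⟨ +-identityʳ _ ⟨
    ones (λ l → tiling ρs l (cell j i)) + 0
      ≡⟨ stack-coverage ρs 0 (λ _ → 0) j i allBounded ⟩
    residueCount (toℕ i) (stackHeight ρs 0 j)
      ≡⟨ cong (residueCount (toℕ i)) (trans (sym (+-identityʳ _)) (stackHeight-residues ρs 0 j)) ⟩
    residueCount (toℕ i) (totalQuot ρs + residueCount (toℕ j) (totalRem ρs)) ∎
    where open ≡-Reasoning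

  totalWeight≡shape : ∀ ρs → All Bounded ρs → totalWeight ρs ≡ totalQuot ρs * p + totalRem ρs
  totalWeight≡shape []       []                    = refl
  totalWeight≡shape (ρ ∷ ρs) (bounded ∷ allBounded) = begin
    weight ρ + totalWeight ρs
      ≡⟨ cong₂ _+_ (weight≡shape ρ bounded) (totalWeight≡shape ρs allBounded) ⟩
    shapeQuot ρ * p + shapeRem ρ + (totalQuot ρs * p + totalRem ρs)
      ≡⟨ regroup (shapeQuot ρ) (totalQuot ρs) (shapeRem ρ) (totalRem ρs) p ⟩
    (shapeQuot ρ + totalQuot ρs) * p + (shapeRem ρ + totalRem ρs) ∎
    where
    open ≡-Reasoning
    regroup : ∀ a a' b b' p → a * p + b + (a' * p + b') ≡ (a + a') * p + (b + b')
    regroup = solve-∀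

  ∀-cell : (P : Fin (p * p) → Set) → (∀ j i → P (cell j i)) → ∀ idx → P idx
  ∀-cell P P-cell idx =
    subst P (combine-remQuot {p} p idx) (P-cell (proj₁ (remQuot {p} p idx)) (proj₂ (remQuot {p} p idx)))

  -- total weight r p² forces total quotient a ≤ r p and total remainder b = (r p ∸ a) p
  tiling-exact : ∀ ρs r → All Bounded ρs → totalWeight ρs ≡ r * (p * p) →
    ∀ idx → ones (λ l → tiling ρs l idx) ≡ r
  tiling-exact ρs r allBounded total≡ = ∀-cell _ λ j i → begin
    ones (λ l → tiling ρs l (cell j i))
      ≡⟨ tiling-coverage ρs j i allBounded ⟩
    residueCount (toℕ i) (a + residueCount (toℕ j) b)
      ≡⟨ cong (λ c → residueCount (toℕ i) (a + c)) (trans (cong (residueCount (toℕ j)) b≡) (residueCount-*p (toℕ j) (r * p ∸ a) (toℕ<n j))) ⟩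
    residueCount (toℕ i) (a + (r * p ∸ a))
      ≡⟨ cong (residueCount (toℕ i)) (m+[n∸m]≡n a≤rp) ⟩
    residueCount (toℕ i) (r * p)
      ≡⟨ residueCount-*p (toℕ i) r (toℕ<n i) ⟩
    r ∎
    where
    open ≡-Reasoning
    a = totalQuot ρs
    b = totalRem ρs
    shape≡ : a * p + b ≡ r * p * p
    shape≡ = trans (sym (totalWeight≡shape ρs allBounded)) (trans total≡ (sym (*-assoc r p p)))
    a≤rp : a ≤ r * p
    a≤rp = *-cancelʳ-≤ a (r * p) p (subst (a * p ≤_) shape≡ (m≤m+n (a * p) b))
    b≡ : b ≡ (r * p ∸ a) * p
    b≡ = trans (sym (m+n∸m≡n (a * p) b)) (trans (cong (_∸ a * p) shape≡) (sym (*-distribʳ-∸ p (r * p) a)))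

  tiling-≤ : ∀ ρs r → All Bounded ρs → totalWeight ρs ≤ r * (p * p) →
    ∀ idx → ones (λ l → tiling ρs l idx) ≤ r
  tiling-≤ ρs r allBounded total≤ = ∀-cell _ λ j i →
    subst (_≤ r) (sym (tiling-coverage ρs j i allBounded)) (residueCount-≤ (toℕ i) r (toℕ<n i) (begin
      a + residueCount (toℕ j) b   ≤⟨ +-monoʳ-≤ a (residueCount-≤ (toℕ j) (r * p ∸ a) (toℕ<n j) b≤) ⟩
      a + (r * p ∸ a)              ≡⟨ m+[n∸m]≡n a≤rp ⟩
      r * p                        ∎))
    where
    open ≤-Reasoning
    a = totalQuot ρs
    b = totalRem ρs
    shape≤ : a * p + b ≤ r * p * p
    shape≤ = subst₂ _≤_ (totalWeight≡shape ρs allBounded) (sym (*-assoc r p p)) total≤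
    a≤rp : a ≤ r * p
    a≤rp = *-cancelʳ-≤ a (r * p) p (≤-trans (m≤m+n (a * p) b) shape≤)
    b≤ : b ≤ (r * p ∸ a) * p
    b≤ = subst (b ≤_) (sym (*-distribʳ-∸ p (r * p) a)) (m+n≤o⇒m≤o∸n b (subst (_≤ r * p * p) (+-comm (a * p) b) shape≤))

  module _ (t : Word → Bool) (cyclic : DoublyCyclic p t) where

    t-stack : ∀ ρs b H → All (Realizable t) ρs → ∀ l → t (stack ρs b H l) ≡ value (λ k → transpose p t ⟨ k ⟩) (lookup ρs l)
    t-stack (ρ ∷ ρs) b H (ok ∷ oks) Fin.zero    = t-word t cyclic ρ (p ∸ b % p) (λ j → p ∸ H j % p) ok
    t-stack (ρ ∷ ρs) b H (ok ∷ oks) (Fin.suc l) = t-stack ρs (b + shapeRem ρ) (λ j → H j + columnHeight ρ b j) oks l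

    t-tiling : ∀ ρs → All (Realizable t) ρs → ∀ l → t (tiling ρs l) ≡ value (λ k → transpose p t ⟨ k ⟩) (lookup ρs l)
    t-tiling ρs = t-stack ρs 0 (λ _ → 0)

-- Selections of rows

sum-replicate : ∀ c x → sum (replicate c x) ≡ c * x
sum-replicate zero    x = refl
sum-replicate (suc c) x = cong (x +_) (sum-replicate c x)

sum-map-++ : ∀ {A : Set} (f : A → ℕ) xs ys → sum (map f (xs ++ ys)) ≡ sum (map f xs) + sum (map f ys)
sum-map-++ f xs ys = trans (cong sum (map-++ f xs ys)) (sum-++ (map f xs) (map f ys))

sum-map-replicate : ∀ {A : Set} (f : A → ℕ) c x → sum (map f (replicate c x)) ≡ c * f x
sum-map-replicate f c x = trans (cong sum (map-replicate f c x)) (sum-replicate c (f x))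

valueCount-true : ∀ G (ρs : List Row) → All (λ ρ → value G ρ ≡ true) ρs → valueCount G ρs ≡ length ρs
valueCount-true G []       []         = refl
valueCount-true G (ρ ∷ ρs) (v≡ ∷ v≡s) = cong₂ (λ b c → ind b + c) v≡ (valueCount-true G ρs v≡s)

valueCount-false : ∀ G (ρs : List Row) → All (λ ρ → value G ρ ≡ false) ρs → valueCount G ρs ≡ 0
valueCount-false G []       []         = refl
valueCount-false G (ρ ∷ ρs) (v≡ ∷ v≡s) = cong₂ (λ b c → ind b + c) v≡ (valueCount-false G ρs v≡s)

module Selections (n : ℕ) where
  open Weights n public

  record Selection (Good : Row → Set) (len total : ℕ) : Set where
    constructor selection
    field
      rows    : List Row
      length≡ : length rows ≡ len
      weight≡ : totalWeight rows ≡ total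
      bounded : All Bounded rows
      good    : All Good rows

  module _ {Good : Row → Set} where

    infixr 5 _⊕_
    _⊕_ : ∀ {a b c d} → Selection Good a b → Selection Good c d → Selection Good (a + c) (b + d)
    selection xs lx wx bx gx ⊕ selection ys ly wy by gy = selection (xs ++ ys)
      (trans (length-++ xs) (cong₂ _+_ lx ly)) (trans (sum-map-++ weight xs ys) (cong₂ _+_ wx wy))
      (++⁺ bx by) (++⁺ gx gy)

    copies : ∀ c ρ → Bounded ρ → Good ρ → Selection Good c (c * weight ρ)
    copies c ρ bounded good = selection (replicate c ρ)
      (length-replicate c) (sum-map-replicate weight c ρ) (replicate⁺ c bounded) (replicate⁺ c good)

    cast : ∀ {a b a' b'} → a ≡ a' → b ≡ b' → Selection Good a b → Selection Good a' b'
    cast refl refl σ = σ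

-- Cases 1–3

module Cases123 (n M : ℕ) (n≡ : n ≡ suc (M + M)) (G : ℕ → Bool) (r₀ : ℕ) where
  open Selections n public

  r : ℕ
  r = 2 + r₀

  Positive : Row → Set
  Positive ρ = value G ρ ≡ true

  -- some row of weight w has value 1
  One : ℕ → Set
  One w = G w ≡ true ⊎ G (n ∸ w) ≡ false

  positives : ∀ {w} → One w → w ≤ n → ∀ c → Selection Positive c (c * w)
  positives {w} (inj₁ Gw)   w≤n c = copies c (orbit w) w≤n Gw
  positives {w} (inj₂ Gn∸w) w≤n c =
    cast refl (cong (c *_) (m∸[m∸n]≡n w≤n)) (copies c (coOrbit (n ∸ w)) (m∸n≤m n w) (cong not Gn∸w))

  ¬One⇒G≡false : ∀ {w} → ¬ One w → G w ≡ false
  ¬One⇒G≡false ¬one = ¬-not (¬one ∘ inj₁)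

  ¬One⇒G[n∸w]≡true : ∀ {w} → ¬ One w → G (n ∸ w) ≡ true
  ¬One⇒G[n∸w]≡true ¬one = ¬-not (¬one ∘ inj₂)

  ¬One⇒One[n∸w] : ∀ {w} → ¬ One w → One (n ∸ w)
  ¬One⇒One[n∸w] ¬one = inj₁ (¬One⇒G[n∸w]≡true ¬one)

  M≤n : M ≤ n
  M≤n = subst (M ≤_) (sym n≡) (≤-trans (m≤m+n M M) (n≤1+n _))

  n-split : ∀ {v u} → v + u ≡ M → n ≡ v + suc (M + u)
  n-split {v} {u} v+u≡M = trans n≡ (trans (cong (λ x → suc (M + x)) (sym v+u≡M)) (rearrange M v u))
    where
    rearrange : ∀ M v u → suc (M + (v + u)) ≡ v + suc (M + u)
    rearrange = solve-∀

  n∸lower : ∀ {v u} → v + u ≡ M → n ∸ v ≡ suc (M + u)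
  n∸lower {v} {u} v+u≡M = trans (cong (_∸ v) (n-split {v} {u} v+u≡M)) (m+n∸m≡n v (suc (M + u)))

  n∸upper : ∀ {v u} → v + u ≡ M → n ∸ suc (M + u) ≡ v
  n∸upper {v} {u} v+u≡M = trans (cong (_∸ suc (M + u)) (n-split {v} {u} v+u≡M)) (m+n∸n≡m v (suc (M + u)))

  lower≤n : ∀ {v u} → v + u ≡ M → v ≤ n
  lower≤n {v} {u} v+u≡M = ≤-trans (subst (v ≤_) v+u≡M (m≤m+n v u)) M≤n

  upper≤n : ∀ u → u ≤ M → suc (M + u) ≤ n
  upper≤n u u≤M = subst (suc (M + u) ≤_) (sym n≡) (s≤s (+-monoʳ-≤ M u≤M))

  upper-split : ∀ {w} → M < w → w < n → Σ[ u ∈ ℕ ] (u ≤ M) × (w ≡ suc (M + u))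
  upper-split {w} M<w w<n = w ∸ suc M , u≤M , sym (m+[n∸m]≡n M<w)
    where
    u≤M : w ∸ suc M ≤ M
    u≤M = subst (w ∸ suc M ≤_) (m+n∸m≡n (suc M) M) (∸-monoˡ-≤ (suc M) (≤-trans (≤-pred (subst (w <_) n≡ w<n)) (n≤1+n (M + M))))

  LowerFree : Set
  LowerFree = ∀ v → v ≤ M → ¬ One v

  UpperFree : Set
  UpperFree = ∀ u → u ≤ M → ¬ One (suc (M + u))

  lowerFree-induction : (One M → ⊥) →
    (∀ {u v} → v + suc u ≡ M → One (suc (M + u)) → One v → ⊥) → LowerFree
  lowerFree-induction base step v v≤M = go (M ∸ v) v (m+[n∸m]≡n v≤M)
    where
    go : ∀ u v → v + u ≡ M → ¬ One v
    go zero    v v+0≡M = subst (λ w → ¬ One w) (trans (sym v+0≡M) (+-identityʳ v)) base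
    go (suc u) v v+u≡M = step v+u≡M (subst One (n∸lower sv+u≡M) (¬One⇒One[n∸w] (go u (suc v) sv+u≡M)))
      where
      sv+u≡M : suc v + u ≡ M
      sv+u≡M = trans (sym (+-suc v u)) v+u≡M

  upperFree-induction : (One (suc (M + 0)) → ⊥) →
    (∀ {u v} → suc u ≤ M → v + u ≡ M → One v → One (suc (M + suc u)) → ⊥) → UpperFree
  upperFree-induction base step zero    _    = base
  upperFree-induction base step (suc u) su≤M =
    step su≤M v+u≡M (subst One (n∸upper v+u≡M) (¬One⇒One[n∸w] (upperFree-induction base step u u≤M)))
    where
    u≤M = ≤-trans (n≤1+n u) su≤M
    v+u≡M : M ∸ u + u ≡ M
    v+u≡M = m∸n+n≡m u≤M

  dichotomy : (One M → UpperFree) → (One (suc (M + 0)) → LowerFree) → LowerFree ⊎ UpperFree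
  dichotomy fromLower fromUpper = decide (G M) refl (G (n ∸ M)) refl
    where
    decide : ∀ a → G M ≡ a → ∀ b → G (n ∸ M) ≡ b → LowerFree ⊎ UpperFree
    decide true  GM _     _     = inj₂ (fromLower (inj₁ GM))
    decide false _  false Gn∸M = inj₂ (fromLower (inj₂ Gn∸M))
    decide false _  true  Gn∸M = inj₁ (fromUpper (subst One (n∸lower (+-identityʳ M)) (inj₁ Gn∸M)))

  k+k<n⇒k≤M : ∀ {k} → k + k < n → k ≤ M
  k+k<n⇒k≤M {k} k+k<n = ≮⇒≥ λ M<k → <-irrefl refl (<-≤-trans k+k<n (subst (_≤ k + k) (sym n≡) (+-mono-≤ M<k (<⇒≤ M<k))))

  n<k+k⇒M<k : ∀ {k} → n < k + k → M < k
  n<k+k⇒M<k {k} n<k+k = ≰⇒> λ k≤M → <-irrefl refl (<-≤-trans n<k+k (subst (k + k ≤_) (sym n≡) (≤-trans (+-mono-≤ k≤M k≤M) (n≤1+n _))))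

  threshold : LowerFree ⊎ UpperFree → ∀ k → k < n →
    (k + k < n → G k ≡ G 0) × (n < k + k → G k ≡ not (G 0))
  threshold (inj₁ lowerFree) k k<n =
      (λ k+k<n → trans (low (k+k<n⇒k≤M k+k<n)) (sym (low z≤n)))
    , (λ n<k+k → trans (high (upper-split (n<k+k⇒M<k n<k+k) k<n)) (cong not (sym (low z≤n))))
    where
    low : ∀ {w} → w ≤ M → G w ≡ false
    low {w} w≤M = ¬One⇒G≡false (lowerFree w w≤M)
    high : (Σ[ u ∈ ℕ ] (u ≤ M) × (k ≡ suc (M + u))) → G k ≡ true
    high (u , u≤M , k≡) = subst (λ w → G w ≡ true) (trans (n∸lower (m∸n+n≡m u≤M)) (sym k≡))
                                (¬One⇒G[n∸w]≡true (lowerFree (M ∸ u) (m∸n≤m M u)))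
  threshold (inj₂ upperFree) k k<n =
      (λ k+k<n → trans (low (k+k<n⇒k≤M k+k<n)) (sym (low z≤n)))
    , (λ n<k+k → trans (high (upper-split (n<k+k⇒M<k n<k+k) k<n)) (cong not (sym (low z≤n))))
    where
    low : ∀ {w} → w ≤ M → G w ≡ true
    low {w} w≤M = subst (λ x → G x ≡ true) (n∸upper (m+[n∸m]≡n w≤M))
                        (¬One⇒G[n∸w]≡true (upperFree (M ∸ w) (m∸n≤m M w)))
    high : (Σ[ u ∈ ℕ ] (u ≤ M) × (k ≡ suc (M + u))) → G k ≡ false
    high (u , u≤M , k≡) = subst (λ w → G w ≡ false) (sym k≡) (¬One⇒G≡false (upperFree u u≤M))

  Forbidden : (ℕ → Set) → Set
  Forbidden Admissible = ∀ {S} → Selection Positive (r + r) S → Admissible S → ⊥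

  scale-n : ∀ {c} → c ≡ r → c * suc (M + M) ≡ r * n
  scale-n c≡r = cong₂ _*_ c≡r (sym n≡)

  -- a total weight that one further row completes to r n
  Paddable : ℕ → Set
  Paddable S = (S ≤ r * n) × (r * n ∸ S ≤ n)

  paddable : ∀ {S} e → S + e ≡ r * n → e ≤ n → Paddable S
  paddable {S} e S+e≡ e≤n =
    subst (S ≤_) S+e≡ (m≤m+n S e) , subst (_≤ n) (sym (trans (cong (_∸ S) (sym S+e≡)) (m+n∸m≡n S e))) e≤n

  module Padded (forbidden : Forbidden Paddable) (r≤n : r ≤ n) where

    lowerFree : One (suc (M + 0)) → LowerFree
    lowerFree one₀ = lowerFree-induction base step
      where
      base : One M → ⊥
      base oneM = forbidden (positives oneM M≤n r ⊕ positives one₀ (upper≤n 0 z≤n) r)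
                            (paddable 0 (trans (identity r M) (scale-n refl)) z≤n)
        where
        identity : ∀ r M → r * M + r * suc (M + 0) + 0 ≡ r * suc (M + M)
        identity = solve-∀
      step : ∀ {u v} → v + suc u ≡ M → One (suc (M + u)) → One v → ⊥
      step {u} {v} v+u≡M oneU oneV =
        forbidden (positives oneV (lower≤n v+u≡M) r ⊕ positives oneU (upper≤n u u≤M) r) (paddable r total≡ r≤n)
        where
        u≤M = ≤-trans (n≤1+n u) (subst (suc u ≤_) v+u≡M (m≤n+m (suc u) v))
        identity : ∀ r v u → r * v + r * suc (v + suc u + u) + r ≡ r * suc (v + suc u + (v + suc u))
        identity = solve-∀
        total≡ : r * v + r * suc (M + u) + r ≡ r * n
        total≡ = trans (subst (λ M' → r * v + r * suc (M' + u) + r ≡ r * suc (M' + M')) v+u≡M (identity r v u)) (scale-n refl)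

    upperFree : One M → UpperFree
    upperFree oneM = upperFree-induction base step
      where
      r₀≤n : r₀ ≤ n
      r₀≤n = ≤-trans (≤-trans (n≤1+n r₀) (n≤1+n (suc r₀))) r≤n
      base : One (suc (M + 0)) → ⊥
      base one₀ = forbidden (positives one₀ (upper≤n 0 z≤n) 1 ⊕ positives oneM M≤n (suc r₀ + r))
                            (paddable (suc r₀) (trans (identity r₀ M) (scale-n refl)) (≤-trans (n≤1+n (suc r₀)) r≤n))
        where
        identity : ∀ r₀ M → 1 * suc (M + 0) + (suc r₀ + (2 + r₀)) * M + suc r₀ ≡ (2 + r₀) * suc (M + M)
        identity = solve-∀
      step : ∀ {u v} → suc u ≤ M → v + u ≡ M → One v → One (suc (M + suc u)) → ⊥
      step {u} {v} su≤M v+u≡M oneV oneU =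
        forbidden (cast length≡ refl (positives oneU (upper≤n (suc u) su≤M) 1 ⊕ positives oneV (lower≤n v+u≡M) 1
                                      ⊕ positives oneM M≤n (suc r₀ + suc r₀)))
                  (paddable r₀ total≡ r₀≤n)
        where
        length≡ : 1 + (1 + (suc r₀ + suc r₀)) ≡ r + r
        length≡ = cong (2 +_) (sym (+-suc r₀ (suc r₀)))
        identity : ∀ r₀ v u → 1 * suc (v + u + suc u) + (1 * v + (suc r₀ + suc r₀) * (v + u)) + r₀
                              ≡ (2 + r₀) * suc (v + u + (v + u))
        identity = solve-∀
        total≡ : 1 * suc (M + suc u) + (1 * v + (suc r₀ + suc r₀) * M) + r₀ ≡ r * n
        total≡ = trans (subst (λ M' → 1 * suc (M' + suc u) + (1 * v + (suc r₀ + suc r₀) * M') + r₀ ≡ (2 + r₀) * suc (M' + M'))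
                              v+u≡M (identity r₀ v u))
                       (scale-n refl)

  module Exact (h : ℕ) (r≡ : r ≡ h + h) (forbidden : Forbidden (_≡ r * n)) where

    length≡ : h + (h + (h + h)) ≡ r + r
    length≡ = trans (sym (+-assoc h h (h + h))) (sym (cong₂ _+_ r≡ r≡))

    lowerFree : One (suc (M + 0)) → LowerFree
    lowerFree one₀ = lowerFree-induction base step
      where
      base : One M → ⊥
      base oneM = forbidden (positives oneM M≤n r ⊕ positives one₀ (upper≤n 0 z≤n) r) (trans (identity r M) (scale-n refl))
        where
        identity : ∀ r M → r * M + r * suc (M + 0) ≡ r * suc (M + M)
        identity = solve-∀
      step : ∀ {u v} → v + suc u ≡ M → One (suc (M + u)) → One v → ⊥
      step {u} {v} v+u≡M oneU oneV =
        forbidden (cast length≡ refl (positives oneV (lower≤n v+u≡M) h ⊕ positives oneU (upper≤n u u≤M) h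
                                      ⊕ positives one₀ (upper≤n 0 z≤n) (h + h)))
                  total≡
        where
        u≤M = ≤-trans (n≤1+n u) (subst (suc u ≤_) v+u≡M (m≤n+m (suc u) v))
        identity : ∀ h v u → h * v + (h * suc (v + suc u + u) + (h + h) * suc (v + suc u + 0))
                             ≡ (h + h) * suc (v + suc u + (v + suc u))
        identity = solve-∀
        total≡ : h * v + (h * suc (M + u) + (h + h) * suc (M + 0)) ≡ r * n
        total≡ = trans (subst (λ M' → h * v + (h * suc (M' + u) + (h + h) * suc (M' + 0)) ≡ (h + h) * suc (M' + M'))
                              v+u≡M (identity h v u))
                       (scale-n (sym r≡))

    upperFree : One M → UpperFree
    upperFree oneM = upperFree-induction base step
      where
      base : One (suc (M + 0)) → ⊥
      base one₀ = forbidden (positives one₀ (upper≤n 0 z≤n) r ⊕ positives oneM M≤n r) (trans (identity r M) (scale-n refl))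
        where
        identity : ∀ r M → r * suc (M + 0) + r * M ≡ r * suc (M + M)
        identity = solve-∀
      step : ∀ {u v} → suc u ≤ M → v + u ≡ M → One v → One (suc (M + suc u)) → ⊥
      step {u} {v} su≤M v+u≡M oneV oneU =
        forbidden (cast length≡ refl (positives oneU (upper≤n (suc u) su≤M) h ⊕ positives oneV (lower≤n v+u≡M) h
                                      ⊕ positives oneM M≤n (h + h)))
                  total≡
        where
        identity : ∀ h v u → h * suc (v + u + suc u) + (h * v + (h + h) * (v + u)) ≡ (h + h) * suc (v + u + (v + u))
        identity = solve-∀
        total≡ : h * suc (M + suc u) + (h * v + (h + h) * M) ≡ r * n
        total≡ = trans (subst (λ M' → h * suc (M' + suc u) + (h * v + (h + h) * M') ≡ (h + h) * suc (M' + M'))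
                              v+u≡M (identity h v u))
                       (scale-n (sym r≡))

-- Case 4

module Case4 (G : ℕ → Bool) (r d m₁ n : ℕ)
  (0<r : 0 < r) (r≤d : r ≤ d) (2≤d : 2 ≤ d)
  (rn≡ : r * n ≡ (r + d) * suc m₁ + r) (2m+1≤n : suc m₁ + suc (suc m₁) ≤ n) where
  open Selections n public

  m : ℕ
  m = suc m₁

  α : Bool
  α = G m

  Mono : Bool → Row → Set
  Mono b (orbit k)   = G k ≡ b
  Mono b (coOrbit k) = ⊥

  Forbidden : Set
  Forbidden = ∀ {b} → Selection (Mono b) (r + d) (r * n) → ⊥

  m+i≤n : ∀ {i} → i ≤ suc m → m + i ≤ n
  m+i≤n i≤sm = ≤-trans (+-monoʳ-≤ m i≤sm) 2m+1≤n

  m≤n : m ≤ n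
  m≤n = ≤-trans (m≤m+n m 0) (m+i≤n z≤n)

  m∸j≤n : ∀ j → m ∸ j ≤ n
  m∸j≤n j = ≤-trans (m∸n≤m m j) m≤n

  mono : ∀ {b} c x → x ≤ n → G x ≡ b → Selection (Mono b) c (c * x)
  mono c x x≤n Gx = copies c (orbit x) x≤n Gx

  G≡α : ∀ {x} → ¬ (G x ≡ not α) → G x ≡ α
  G≡α ¬β = trans (¬-not ¬β) (not-involutive α)

  G≡not-α : ∀ {x} → ¬ (G x ≡ α) → G x ≡ not α
  G≡not-α = ¬-not

  Supply : Bool → ℕ → Set
  Supply b D = ∀ x → 1 ≤ x → x ≤ D → (m + x ≤ n) × (G (m + x) ≡ b)

  -- greedily: rows m + D while the others can still reach S, then m + (S ∸ K) and rows m + 1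
  spread : ∀ {b} K D S → K ≤ S → S ≤ K * D → Supply b D → Selection (Mono b) K (K * m + S)
  spread zero D S K≤S S≤KD supply = cast refl (sym (n≤0⇒n≡0 S≤KD)) (selection [] refl refl [] [])
  spread {b} (suc K) D S K<S S≤KD supply with D ≤? S ∸ K
  ... | yes D≤S∸K = cast refl total≡ (single D 1≤D ≤-refl ⊕ spread K D (S ∸ D) K≤S∸D S∸D≤KD supply)
    where
    1≤D : 1 ≤ D
    1≤D = n≢0⇒n>0 λ D≡0 → <⇒≱ (≤-trans (s≤s z≤n) K<S) (subst (S ≤_) (trans (cong (suc K *_) D≡0) (*-zeroʳ (suc K))) S≤KD)
    single : ∀ x → 1 ≤ x → x ≤ D → Selection (Mono b) 1 (1 * (m + x))
    single x 1≤x x≤D = mono 1 (m + x) (proj₁ (supply x 1≤x x≤D)) (proj₂ (supply x 1≤x x≤D))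
    K≤S∸D : K ≤ S ∸ D
    K≤S∸D = m+n≤o⇒m≤o∸n K (subst (_≤ S) (+-comm D K) (subst (D + K ≤_) (m∸n+n≡m (<⇒≤ K<S)) (+-monoˡ-≤ K D≤S∸K)))
    S∸D≤KD : S ∸ D ≤ K * D
    S∸D≤KD = subst (S ∸ D ≤_) (m+n∸m≡n D (K * D)) (∸-monoˡ-≤ D S≤KD)
    total≡ : 1 * (m + D) + (K * m + (S ∸ D)) ≡ suc K * m + S
    total≡ = trans (regroup m D (K * m) (S ∸ D)) (cong (m + K * m +_) (m+[n∸m]≡n (≤-trans D≤S∸K (m∸n≤m S K))))
      where
      regroup : ∀ m D Km S' → 1 * (m + D) + (Km + S') ≡ m + Km + (D + S')
      regroup = solve-∀
  ... | no D≰S∸K = cast refl total≡ (single ⊕ spread K D K ≤-refl K≤KD supply)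
    where
    x = S ∸ K
    1≤x : 1 ≤ x
    1≤x = m<n⇒0<n∸m K<S
    x≤D : x ≤ D
    x≤D = <⇒≤ (≰⇒> D≰S∸K)
    single : Selection (Mono b) 1 (1 * (m + x))
    single = mono 1 (m + x) (proj₁ (supply x 1≤x x≤D)) (proj₂ (supply x 1≤x x≤D))
    K≤KD : K ≤ K * D
    K≤KD = subst (_≤ K * D) (*-identityʳ K) (*-monoʳ-≤ K (≤-trans 1≤x x≤D))
    total≡ : 1 * (m + x) + (K * m + K) ≡ suc K * m + S
    total≡ = trans (regroup m x (K * m) K) (cong (m + K * m +_) (m∸n+n≡m (<⇒≤ K<S)))
      where
      regroup : ∀ m x Km K → 1 * (m + x) + (Km + K) ≡ m + Km + (x + K)
      regroup = solve-∀

  ParityCondition : Set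
  ParityCondition = (Σ[ e ∈ ℕ ] d ≡ e + e) ⊎ (Σ[ h ∈ ℕ ] Σ[ e ∈ ℕ ] (r ≡ suc h + suc h) × (d ≡ suc (e + e)))

  d∸1 : ℕ
  d∸1 = d ∸ 1

  d≡ : d ≡ suc d∸1
  d≡ = sym (m+[n∸m]≡n (≤-trans (s≤s z≤n) 2≤d))

  ⌈d/3⌉ : ℕ
  ⌈d/3⌉ = (d + 2) / 3

  3⌈d/3⌉≤d+2 : ⌈d/3⌉ * 3 ≤ d + 2
  3⌈d/3⌉≤d+2 = subst (⌈d/3⌉ * 3 ≤_) (sym (m≡m%n+[m/n]*n (d + 2) 3)) (m≤n+m (⌈d/3⌉ * 3) ((d + 2) % 3))

  d≤3⌈d/3⌉ : d ≤ ⌈d/3⌉ * 3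
  d≤3⌈d/3⌉ = +-cancelʳ-≤ 2 d (⌈d/3⌉ * 3) (begin
    d + 2                    ≡⟨ m≡m%n+[m/n]*n (d + 2) 3 ⟩
    (d + 2) % 3 + ⌈d/3⌉ * 3  ≤⟨ +-monoˡ-≤ (⌈d/3⌉ * 3) (≤-pred (m%n<n (d + 2) 3)) ⟩
    2 + ⌈d/3⌉ * 3            ≡⟨ +-comm 2 (⌈d/3⌉ * 3) ⟩
    ⌈d/3⌉ * 3 + 2            ∎)
    where open ≤-Reasoning

  ⌈d/3⌉≤d : ⌈d/3⌉ ≤ d
  ⌈d/3⌉≤d = *-cancelʳ-≤ ⌈d/3⌉ d 3 (≤-trans 3⌈d/3⌉≤d+2 (begin
    d + 2         ≤⟨ +-monoʳ-≤ d (≤-trans 2≤d (m≤m+n d d)) ⟩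
    d + (d + d)   ≡⟨ thrice d ⟩
    d * 3         ∎))
    where
    open ≤-Reasoning
    thrice : ∀ d → d + (d + d) ≡ d * 3
    thrice = solve-∀

  r+2⌈d/3⌉j≤[r+d]j : ∀ j → 2 ≤ j → suc j < d → r + ⌈d/3⌉ * j + ⌈d/3⌉ * j ≤ (r + d) * j
  r+2⌈d/3⌉j≤[r+d]j j 2≤j sj<d = *-cancelˡ-≤ 3 (begin
    3 * (r + c * j + c * j)         ≡⟨ expand₁ r c j ⟩
    3 * r + 2 * j * (c * 3)         ≤⟨ +-monoʳ-≤ (3 * r) (*-monoʳ-≤ (2 * j) 3⌈d/3⌉≤d+2) ⟩
    3 * r + 2 * j * (d + 2)         ≡⟨ expand₂ r j d ⟩
    3 * r + 4 * j + 2 * j * d       ≤⟨ +-monoˡ-≤ (2 * j * d) (+-mono-≤ (*-monoʳ-≤ 3 (m≤m*n r j {{j≢0}})) 4j≤jd) ⟩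
    3 * (r * j) + j * d + 2 * j * d ≡⟨ expand₃ r j d ⟩
    3 * ((r + d) * j)               ∎)
    where
    open ≤-Reasoning
    c = ⌈d/3⌉
    j≢0 = >-nonZero (≤-trans (s≤s z≤n) 2≤j)
    4j≤jd : 4 * j ≤ j * d
    4j≤jd = subst (_≤ j * d) (*-comm j 4) (*-monoʳ-≤ j (≤-trans (s≤s (s≤s 2≤j)) sj<d))
    expand₁ : ∀ r c j → 3 * (r + c * j + c * j) ≡ 3 * r + 2 * j * (c * 3)
    expand₁ = solve-∀
    expand₂ : ∀ r j d → 3 * r + 2 * j * (d + 2) ≡ 3 * r + 4 * j + 2 * j * d
    expand₂ = solve-∀
    expand₃ : ∀ r j d → 3 * (r * j) + j * d + 2 * j * d ≡ 3 * ((r + d) * j)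
    expand₃ = solve-∀

  -- Each step refutes the other value by r + d rows of one common value and total weight
  -- r n = (r + d) m + r, listed above it.
  module _ (forbidden : Forbidden) where

    -- d rows m and r rows m + 1
    β₁ : G (m + 1) ≡ not α
    β₁ = G≡not-α λ Gm+1≡α → forbidden (cast (+-comm d r) (trans (identity r d m) (sym rn≡))
                                              (mono d m m≤n refl ⊕ mono r (m + 1) (m+i≤n (s≤s z≤n)) Gm+1≡α))
      where
      identity : ∀ r d m → d * m + r * (m + 1) ≡ (r + d) * m + r
      identity = solve-∀

    -- r rows m + i + 1, r rows m ∸ i and d ∸ r rows m
    β-step : ∀ i → i ≤ m → G (m ∸ i) ≡ α → G (m + suc i) ≡ not α
    β-step i i≤m Gm∸i = G≡not-α λ G≡α →
      forbidden (cast length≡ (trans total≡ (sym rn≡))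
                      (mono r (m + suc i) (m+i≤n (s≤s i≤m)) G≡α ⊕ mono r (m ∸ i) (m∸j≤n i) Gm∸i ⊕ mono (d ∸ r) m m≤n refl))
      where
      length≡ : r + (r + (d ∸ r)) ≡ r + d
      length≡ = cong (r +_) (m+[n∸m]≡n r≤d)
      identity : ∀ r i v d' → r * (i + v + suc i) + (r * v + d' * (i + v)) ≡ (r + (r + d')) * (i + v) + r
      identity = solve-∀
      total≡ : r * (m + suc i) + (r * (m ∸ i) + (d ∸ r) * m) ≡ (r + d) * m + r
      total≡ = subst (λ M → r * (M + suc i) + (r * (m ∸ i) + (d ∸ r) * M) ≡ (r + d) * M + r) (m+[n∸m]≡n i≤m)
                     (trans (identity r i (m ∸ i) (d ∸ r)) (cong (λ D → (r + D) * (i + (m ∸ i)) + r) (m+[n∸m]≡n r≤d)))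

    -- e rows m ∸ 1 and r + e rows m + 1
    α₁-when-d-even : ∀ e → d ≡ e + e → G m₁ ≡ α
    α₁-when-d-even e d≡ = G≡α λ Gm₁ →
      forbidden (cast length≡ (trans total≡ (sym rn≡)) (mono e m₁ (m∸j≤n 1) Gm₁ ⊕ mono (r + e) (m + 1) (m+i≤n (s≤s z≤n)) β₁))
      where
      lengths : ∀ e r → e + (r + e) ≡ r + (e + e)
      lengths = solve-∀
      length≡ : e + (r + e) ≡ r + d
      length≡ = trans (lengths e r) (cong (r +_) (sym d≡))
      identity : ∀ e r m₁ → e * m₁ + (r + e) * (suc m₁ + 1) ≡ (r + (e + e)) * suc m₁ + r
      identity = solve-∀
      total≡ : e * m₁ + (r + e) * (m + 1) ≡ (r + d) * m + r
      total≡ = trans (identity e r m₁) (cong (λ D → (r + D) * m + r) (sym d≡))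

    -- r / 2 rows m + 2 and r / 2 + d rows m
    β₂-when-r-even : ∀ h → r ≡ suc h + suc h → G (m + 2) ≡ not α
    β₂-when-r-even h r≡ = G≡not-α λ Gm+2 →
      forbidden (cast length≡ (trans total≡ (sym rn≡)) (mono (suc h) (m + 2) (m+i≤n (s≤s (s≤s z≤n))) Gm+2 ⊕ mono (suc h + d) m m≤n refl))
      where
      length≡ : suc h + (suc h + d) ≡ r + d
      length≡ = trans (sym (+-assoc (suc h) (suc h) d)) (cong (_+ d) (sym r≡))
      identity : ∀ h d m → suc h * (m + 2) + (suc h + d) * m ≡ (suc h + suc h + d) * m + (suc h + suc h)
      identity = solve-∀
      total≡ : suc h * (m + 2) + (suc h + d) * m ≡ (r + d) * m + r
      total≡ = trans (identity h d m) (cong (λ R → (R + d) * m + R) (sym r≡))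

    -- (d + 1) / 2 rows m ∸ 1, one row m + 2 and r + (d − 1) / 2 − 1 rows m + 1
    α₁-when-d-odd : ∀ h e → r ≡ suc h + suc h → d ≡ suc (e + e) → G (m + 2) ≡ not α → G m₁ ≡ α
    α₁-when-d-odd h e r≡ d≡ β₂ = G≡α λ Gm₁ →
      forbidden (cast length≡ (trans total≡ (sym rn≡))
                      (mono (suc e) m₁ (m∸j≤n 1) Gm₁ ⊕ mono 1 (m + 2) (m+i≤n (s≤s (s≤s z≤n))) β₂
                       ⊕ mono (h + suc h + e) (m + 1) (m+i≤n (s≤s z≤n)) β₁))
      where
      lengths : ∀ h e → suc e + (1 + (h + suc h + e)) ≡ suc h + suc h + suc (e + e)
      lengths = solve-∀
      length≡ : suc e + (1 + (h + suc h + e)) ≡ r + d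
      length≡ = trans (lengths h e) (sym (cong₂ _+_ r≡ d≡))
      identity : ∀ h e m₁ → suc e * m₁ + (1 * (suc m₁ + 2) + (h + suc h + e) * (suc m₁ + 1))
                            ≡ (suc h + suc h + suc (e + e)) * suc m₁ + (suc h + suc h)
      identity = solve-∀
      total≡ : suc e * m₁ + (1 * (m + 2) + (h + suc h + e) * (m + 1)) ≡ (r + d) * m + r
      total≡ = trans (identity h e m₁) (sym (cong₂ (λ R D → (R + D) * m + R) r≡ d≡))

    base : ParityCondition → (G m₁ ≡ α) × (G (m + 2) ≡ not α)
    base (inj₁ (e , d≡)) = α₁ , β-step 1 (s≤s z≤n) α₁
      where
      α₁ = α₁-when-d-even e d≡
    base (inj₂ (h , e , r≡ , d≡)) = α₁-when-d-odd h e r≡ d≡ β₂ , β₂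
      where
      β₂ = β₂-when-r-even h r≡

    -- one row m ∸ j and r + d ∸ 1 rows just above m
    α-step-narrow : ∀ j → .{{NonZero j}} → j ≤ m → d ≤ suc j → Supply (not α) j → ¬ (G (m ∸ j) ≡ not α)
    α-step-narrow j j≤m d≤sj supply Gm∸j =
      forbidden (cast length≡ (trans total≡ (sym rn≡)) (mono 1 (m ∸ j) (m∸j≤n j) Gm∸j ⊕ spread (r + d∸1) j (r + j) K≤S S≤Kj supply))
      where
      instance
        d∸1≢0 : NonZero d∸1
        d∸1≢0 = >-nonZero (≤-pred (subst (2 ≤_) d≡ 2≤d))
      length≡ : 1 + (r + d∸1) ≡ r + d
      length≡ = trans (sym (+-suc r d∸1)) (cong (r +_) (sym d≡))
      K≤S : r + d∸1 ≤ r + j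
      K≤S = +-monoʳ-≤ r (≤-pred (subst (_≤ suc j) d≡ d≤sj))
      S≤Kj : r + j ≤ (r + d∸1) * j
      S≤Kj = ≤-trans (+-mono-≤ (m≤m*n r j) (m≤n*m j d∸1)) (≤-reflexive (sym (*-distribʳ-+ j r d∸1)))
      identity : ∀ v j r d₀ → 1 * v + ((r + d₀) * (j + v) + (r + j)) ≡ (r + suc d₀) * (j + v) + r
      identity = solve-∀
      total≡ : 1 * (m ∸ j) + ((r + d∸1) * m + (r + j)) ≡ (r + d) * m + r
      total≡ = subst (λ M → 1 * (m ∸ j) + ((r + d∸1) * M + (r + j)) ≡ (r + d) * M + r) (m+[n∸m]≡n j≤m)
                     (trans (identity (m ∸ j) j r d∸1) (cong (λ D → (r + D) * (j + (m ∸ j)) + r) (sym d≡)))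

    -- c = ⌈d / 3⌉ rows m ∸ j and r + d ∸ c rows just above m
    α-step-wide : ∀ j → 2 ≤ j → j ≤ m → suc j < d → Supply (not α) j → ¬ (G (m ∸ j) ≡ not α)
    α-step-wide j 2≤j j≤m sj<d supply Gm∸j =
      forbidden (cast length≡ (trans total≡ (sym rn≡)) (mono c (m ∸ j) (m∸j≤n j) Gm∸j ⊕ spread (r + d₃) j (r + c * j) K≤S S≤Kj supply))
      where
      c = ⌈d/3⌉
      d₃ = d ∸ c
      c+d₃≡d : c + d₃ ≡ d
      c+d₃≡d = m+[n∸m]≡n ⌈d/3⌉≤d
      length≡ : c + (r + d₃) ≡ r + d
      length≡ = trans (left-comm c r d₃) (cong (r +_) c+d₃≡d)
        where
        left-comm : ∀ a b c → a + (b + c) ≡ b + (a + c)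
        left-comm = solve-∀
      K≤S : r + d₃ ≤ r + c * j
      K≤S = +-monoʳ-≤ r (+-cancelˡ-≤ c d₃ (c * j) (begin
        c + d₃       ≡⟨ c+d₃≡d ⟩
        d            ≤⟨ d≤3⌈d/3⌉ ⟩
        c * 3        ≤⟨ *-monoʳ-≤ c (s≤s 2≤j) ⟩
        c * suc j    ≡⟨ *-suc c j ⟩
        c + c * j    ∎))
        where open ≤-Reasoning
      S≤Kj : r + c * j ≤ (r + d₃) * j
      S≤Kj = +-cancelʳ-≤ (c * j) (r + c * j) ((r + d₃) * j)
               (≤-trans (r+2⌈d/3⌉j≤[r+d]j j 2≤j sj<d) (≤-reflexive (trans (cong (λ D → (r + D) * j) (sym c+d₃≡d)) (split r c d₃ j))))
        where
        split : ∀ r c d₃ j → (r + (c + d₃)) * j ≡ (r + d₃) * j + c * j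
        split = solve-∀
      identity : ∀ c v j r d₃ → c * v + ((r + d₃) * (j + v) + (r + c * j)) ≡ (r + (c + d₃)) * (j + v) + r
      identity = solve-∀
      total≡ : c * (m ∸ j) + ((r + d₃) * m + (r + c * j)) ≡ (r + d) * m + r
      total≡ = subst (λ M → c * (m ∸ j) + ((r + d₃) * M + (r + c * j)) ≡ (r + d) * M + r) (m+[n∸m]≡n j≤m)
                     (trans (identity c (m ∸ j) j r d₃) (cong (λ D → (r + D) * (j + (m ∸ j)) + r) c+d₃≡d))

    α-step : ∀ j → 2 ≤ j → j ≤ m → (∀ x → 1 ≤ x → x ≤ j → G (m + x) ≡ not α) → G (m ∸ j) ≡ α
    α-step j 2≤j j≤m β≤j = G≡α (by-width (d ≤? suc j))
      where
      supply : Supply (not α) j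
      supply x 1≤x x≤j = m+i≤n (≤-trans x≤j (≤-trans j≤m (n≤1+n m))) , β≤j x 1≤x x≤j
      by-width : Dec (d ≤ suc j) → ¬ (G (m ∸ j) ≡ not α)
      by-width (yes d≤sj) = α-step-narrow j {{>-nonZero (≤-trans (s≤s z≤n) 2≤j)}} j≤m d≤sj supply
      by-width (no d≰sj)  = α-step-wide j 2≤j j≤m (≰⇒> d≰sj) supply

    module _ (parity : ParityCondition) where

      Polarized : ℕ → Set
      Polarized J = (∀ j → j ≤ J → j ≤ m → G (m ∸ j) ≡ α) × (∀ i → 1 ≤ i → i ≤ suc J → i ≤ m → G (m + i) ≡ not α)

      polarized : ∀ J → Polarized (suc J)
      polarized zero = below , above
        where
        below : ∀ j → j ≤ 1 → j ≤ m → G (m ∸ j) ≡ α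
        below zero          _             _ = refl
        below (suc zero)    _             _ = proj₁ (base parity)
        below (suc (suc _)) (s≤s ())      _
        above : ∀ i → 1 ≤ i → i ≤ 2 → i ≤ m → G (m + i) ≡ not α
        above (suc zero)          _ _                  _ = β₁
        above (suc (suc zero))    _ _                  _ = proj₂ (base parity)
        above (suc (suc (suc _))) _ (s≤s (s≤s ()))     _
      polarized (suc J) = below , above
        where
        below : ∀ j → j ≤ suc (suc J) → j ≤ m → G (m ∸ j) ≡ α
        below j j≤ j≤m with m≤n⇒m<n∨m≡n j≤
        ... | inj₁ j<  = proj₁ (polarized J) j (≤-pred j<) j≤m
        ... | inj₂ refl = α-step j (s≤s (s≤s z≤n)) j≤m (λ x 1≤x x≤j → proj₂ (polarized J) x 1≤x x≤j (≤-trans x≤j j≤m))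
        above : ∀ i → 1 ≤ i → i ≤ suc (suc (suc J)) → i ≤ m → G (m + i) ≡ not α
        above i 1≤i i≤ i≤m with m≤n⇒m<n∨m≡n i≤
        ... | inj₁ i<  = proj₂ (polarized J) i 1≤i (≤-pred i<) i≤m
        ... | inj₂ refl = β-step (suc (suc J)) (≤-trans (n≤1+n _) i≤m) (below (suc (suc J)) ≤-refl (≤-trans (n≤1+n _) i≤m))

      G[m∸j] : ∀ j → j ≤ m → G (m ∸ j) ≡ α
      G[m∸j] j j≤m = proj₁ (polarized m) j (≤-trans j≤m (n≤1+n m)) j≤m

      G[m+i] : ∀ i → 1 ≤ i → i ≤ m → G (m + i) ≡ not α
      G[m+i] i 1≤i i≤m = proj₂ (polarized m) i 1≤i (≤-trans i≤m (≤-trans (n≤1+n m) (n≤1+n (suc m)))) i≤m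

      G0≡α : G 0 ≡ α
      G0≡α = subst (λ x → G x ≡ α) (n∸n≡0 m) (G[m∸j] m ≤-refl)

      rn≤[r+d]sm : r * n ≤ (r + d) * suc m
      rn≤[r+d]sm = begin
        r * n                  ≡⟨ rn≡ ⟩
        (r + d) * m + r        ≤⟨ +-monoʳ-≤ ((r + d) * m) (m≤m+n r d) ⟩
        (r + d) * m + (r + d)  ≡⟨ +-comm ((r + d) * m) (r + d) ⟩
        (r + d) + (r + d) * m  ≡⟨ *-suc (r + d) m ⟨
        (r + d) * suc m        ∎
        where open ≤-Reasoning

      2rn≤[r+d]s[m+m] : 2 * r * n ≤ (r + d) * suc (m + m)
      2rn≤[r+d]s[m+m] = begin
        2 * r * n                          ≡⟨ *-assoc 2 r n ⟩
        2 * (r * n)                        ≡⟨ cong (2 *_) rn≡ ⟩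
        2 * ((r + d) * m + r)              ≡⟨ double (r + d) m r ⟩
        (r + d) * (m + m) + (r + r)        ≤⟨ +-monoʳ-≤ ((r + d) * (m + m)) (+-monoʳ-≤ r r≤d) ⟩
        (r + d) * (m + m) + (r + d)        ≡⟨ +-comm ((r + d) * (m + m)) (r + d) ⟩
        (r + d) + (r + d) * (m + m)        ≡⟨ *-suc (r + d) (m + m) ⟨
        (r + d) * suc (m + m)              ∎
        where
        open ≤-Reasoning
        double : ∀ s m r → 2 * (s * m + r) ≡ s * (m + m) + (r + r)
        double = solve-∀

      threshold : ∀ k → (r + d) * k < 2 * r * n →
        ((r + d) * k < r * n → G k ≡ G 0) × (r * n < (r + d) * k → G k ≡ not (G 0))
      threshold k below2rn = lower , upper
        where
        lower : (r + d) * k < r * n → G k ≡ G 0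
        lower belowRn = trans (subst (λ x → G x ≡ α) (m∸[m∸n]≡n k≤m) (G[m∸j] (m ∸ k) (m∸n≤m m k))) (sym G0≡α)
          where
          k≤m : k ≤ m
          k≤m = ≤-pred (*-cancelˡ-< (r + d) k (suc m) (<-≤-trans belowRn rn≤[r+d]sm))
        upper : r * n < (r + d) * k → G k ≡ not (G 0)
        upper aboveRn = trans (subst (λ x → G x ≡ not α) (m+[n∸m]≡n (<⇒≤ m<k)) (G[m+i] (k ∸ m) (m<n⇒0<n∸m m<k) k∸m≤m))
                              (cong not (sym G0≡α))
          where
          m<k : m < k
          m<k = *-cancelˡ-< (r + d) m k (≤-<-trans (≤-trans (m≤m+n ((r + d) * m) r) (≤-reflexive (sym rn≡))) aboveRn)
          k≤m+m : k ≤ m + m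
          k≤m+m = ≤-pred (*-cancelˡ-< (r + d) k (suc (m + m)) (<-≤-trans below2rn 2rn≤[r+d]s[m+m]))
          k∸m≤m : k ∸ m ≤ m
          k∸m≤m = subst (k ∸ m ≤_) (m+n∸n≡m m m) (∸-monoˡ-≤ m k≤m+m)

-- Arithmetic of p

even-or-odd : ∀ x → (Σ[ e ∈ ℕ ] x ≡ e + e) ⊎ (Σ[ e ∈ ℕ ] x ≡ suc (e + e))
even-or-odd zero    = inj₁ (0 , refl)
even-or-odd (suc x) with even-or-odd x
... | inj₁ (e , x≡) = inj₂ (e , cong suc x≡)
... | inj₂ (e , x≡) = inj₁ (suc e , cong suc (trans x≡ (sym (+-suc e e))))

half : ∀ {r} → 2 ∣ r → Σ[ h ∈ ℕ ] r ≡ h + h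
half (divides h r≡) = h , trans r≡ (twice h)
  where
  twice : ∀ h → h * 2 ≡ h + h
  twice = solve-∀

prime⇒1≤q : ∀ q s → Prime (suc (q * s)) → 1 ≤ q
prime⇒1≤q zero    s isPrime = ⊥-elim (nonTrivial⇒≢1 {{prime⇒nonTrivial isPrime}} refl)
prime⇒1≤q (suc q) s isPrime = s≤s z≤n

prime⇒even-predecessor : ∀ Q → Prime (suc Q) → 2 ≤ Q → Σ[ a ∈ ℕ ] Q ≡ a + a
prime⇒even-predecessor Q isPrime 2≤Q with even-or-odd Q
... | inj₁ even = even
... | inj₂ (zero , refl) = ⊥-elim (1+n≰n 2≤Q)
... | inj₂ (suc e , Q≡) = ⊥-elim (prime⇒¬composite isPrime (hasNonTrivialDivisor {divisor = 2} 2<1+Q (divides (suc (suc e)) 1+Q≡)))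
  where
  2<1+Q : 2 < suc Q
  2<1+Q = s≤s 2≤Q
  1+Q≡ : suc Q ≡ suc (suc e) * 2
  1+Q≡ = trans (cong suc Q≡) (double e)
    where
    double : ∀ e → suc (suc (suc e + suc e)) ≡ suc (suc e) * 2
    double = solve-∀

odd-prime-square : ∀ Q → Prime (suc Q) → 2 ≤ Q → Σ[ M ∈ ℕ ] suc Q * suc Q ≡ suc (M + M)
odd-prime-square Q isPrime 2≤Q with prime⇒even-predecessor Q isPrime 2≤Q
... | a , refl = a + a + (a + a) * a , square a
  where
  square : ∀ a → suc (a + a) * suc (a + a) ≡ suc (a + a + (a + a) * a + (a + a + (a + a) * a))
  square = solve-∀

module Transposed (q : ℕ) (t : (Fin (suc q * suc q) → Bool) → Bool) (cyclic : DoublyCyclic (suc q) t) where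
  open Tiling q public

  G : ℕ → Bool
  G k = transpose p t ⟨ k ⟩

  -- the polymorphism condition for relations defined by their number of ones
  Transfers : ℕ → (ℕ → Set) → (ℕ → Set) → Set
  Transfers s Pᶜ Qᶜ = (u : Fin (p * p) → Fin s → Bool) → (∀ i → Pᶜ (ones (u i))) → Qᶜ (ones (λ j → t (λ i → u i j)))

  Threshold : ℕ → ℕ → Set
  Threshold θn θd = ∀ k → θd * k < 2 * θn * (p * p) →
    ((θd * k < θn * (p * p)) → G k ≡ G 0) × ((θd * k > θn * (p * p)) → G k ≡ not (G 0))

  transfer : ∀ {s} Pᶜ Qᶜ → Transfers s Pᶜ Qᶜ → ∀ ρs → length ρs ≡ s → All (Realizable t) ρs →
    (∀ idx → Pᶜ (ones (λ l → tiling ρs l idx))) → Qᶜ (valueCount G ρs)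
  transfer Pᶜ Qᶜ poly ρs refl realizable coverage =
    subst Qᶜ (trans (ones-cong (t-tiling t cyclic ρs realizable)) (ones-lookup G ρs)) (poly (λ idx l → tiling ρs l idx) coverage)

  module OddSquare (M : ℕ) (n≡ : p * p ≡ suc (M + M)) (r₀ : ℕ) (selfDual : SelfDual t) where
    open Cases123 (p * p) M n≡ G r₀ public hiding (weight; totalWeight; Bounded)

    realizable : ∀ ρs → All (Realizable t) ρs
    realizable []             = []
    realizable (orbit _ ∷ ρs)   = tt ∷ realizable ρs
    realizable (coOrbit _ ∷ ρs) = selfDual ∷ realizable ρs

    too-many : ¬ (r + r ≤ 2 * r ∸ 1)
    too-many le = 1+n≰n (≤-trans le (≤-reflexive (cong (λ x → r + x ∸ 1) (+-identityʳ r))))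

    threshold-½ : LowerFree ⊎ UpperFree → Threshold 1 2
    threshold-½ free k 2k<2n with threshold free k (*-cancelˡ-< 2 k (p * p) 2k<2n)
    ... | below , above = (λ 2k<n → below (subst₂ _<_ 2k≡k+k (+-identityʳ (p * p)) 2k<n))
                        , (λ n<2k → above (subst₂ _<_ (+-identityʳ (p * p)) 2k≡k+k n<2k))
      where
      2k≡k+k : 2 * k ≡ k + k
      2k≡k+k = cong (k +_) (+-identityʳ k)

    -- one row of weight r n ∸ S and weightless rows complete the selection to s rows of total weight r n
    forbidden-padded : ∀ s → suc (r + r) ≤ s → Transfers s (_≡ r) (_≤ 2 * r ∸ 1) → Forbidden Paddable
    forbidden-padded s 2r<s poly {S} (selection ρs length≡ weight≡ bounded positive) (S≤rn , rn∸S≤n) =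
      too-many (begin
        r + r                                   ≡⟨ trans (valueCount-true G ρs positive) length≡ ⟨
        valueCount G ρs                         ≤⟨ m≤m+n (valueCount G ρs) (valueCount G padding) ⟩
        valueCount G ρs + valueCount G padding  ≡⟨ sum-map-++ (ind ∘ value G) ρs padding ⟨
        valueCount G (ρs ++ padding)            ≤⟨ transfer (_≡ r) (_≤ 2 * r ∸ 1) poly (ρs ++ padding) length≡s (realizable _) (tiling-exact _ r bounded′ total≡) ⟩
        2 * r ∸ 1                               ∎)
      where
      open ≤-Reasoning
      extra = s ∸ suc (r + r)
      padding = orbit (r * (p * p) ∸ S) ∷ replicate extra (orbit 0)
      length≡s : length (ρs ++ padding) ≡ s
      length≡s = begin-equality
        length (ρs ++ padding)        ≡⟨ length-++ ρs ⟩
        length ρs + suc (length (replicate extra (orbit 0))) ≡⟨ cong₂ (λ a b → a + suc b) length≡ (length-replicate extra) ⟩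
        r + r + suc extra             ≡⟨ +-suc (r + r) extra ⟩
        suc (r + r) + extra           ≡⟨ m+[n∸m]≡n 2r<s ⟩
        s                             ∎
      total≡ : totalWeight (ρs ++ padding) ≡ r * (p * p)
      total≡ = begin-equality
        totalWeight (ρs ++ padding)
          ≡⟨ sum-map-++ weight ρs padding ⟩
        totalWeight ρs + (r * (p * p) ∸ S + totalWeight (replicate extra (orbit 0)))
          ≡⟨ cong₂ (λ a b → a + (r * (p * p) ∸ S + b)) weight≡ (trans (sum-map-replicate weight extra (orbit 0)) (*-zeroʳ extra)) ⟩
        S + (r * (p * p) ∸ S + 0)
          ≡⟨ cong (S +_) (+-identityʳ _) ⟩
        S + (r * (p * p) ∸ S)
          ≡⟨ m+[n∸m]≡n S≤rn ⟩
        r * (p * p) ∎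
      bounded′ : All Bounded (ρs ++ padding)
      bounded′ = ++⁺ bounded (rn∸S≤n ∷ replicate⁺ extra z≤n)

    forbidden-slack : ∀ s → r + r ≡ s → Transfers s (_≤ r) (_≤ 2 * r ∸ 1) → Forbidden Paddable
    forbidden-slack s 2r≡s poly (selection ρs length≡ weight≡ bounded positive) (S≤rn , _) =
      too-many (subst (_≤ 2 * r ∸ 1) (trans (valueCount-true G ρs positive) length≡)
        (transfer (_≤ r) (_≤ 2 * r ∸ 1) poly ρs (trans length≡ 2r≡s) (realizable ρs) (tiling-≤ ρs r bounded (subst (_≤ r * (p * p)) (sym weight≡) S≤rn))))

    forbidden-exact : ∀ s → r + r ≡ s → Transfers s (_≡ r) (_≤ 2 * r ∸ 1) → Forbidden (_≡ r * (p * p))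
    forbidden-exact s 2r≡s poly (selection ρs length≡ weight≡ bounded positive) S≡rn =
      too-many (subst (_≤ 2 * r ∸ 1) (trans (valueCount-true G ρs positive) length≡)
        (transfer (_≡ r) (_≤ 2 * r ∸ 1) poly ρs (trans length≡ 2r≡s) (realizable ρs) (tiling-exact ρs r bounded (trans weight≡ S≡rn))))

  module Case4Tiling (r d m₁ : ℕ) (0<r : 0 < r) (r≤d : r ≤ d) (2≤d : 2 ≤ d)
    (rn≡ : r * (p * p) ≡ (r + d) * suc m₁ + r) (2m+1≤n : suc m₁ + suc (suc m₁) ≤ p * p) where
    open Case4 G r d m₁ (p * p) 0<r r≤d 2≤d rn≡ 2m+1≤n public hiding (weight; totalWeight; Bounded)

    mono⇒realizable : ∀ {b ρs} → All (Mono b) ρs → All (Realizable t) ρs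
    mono⇒realizable {ρs = []}          []        = []
    mono⇒realizable {ρs = orbit _ ∷ _} (_ ∷ mono) = tt ∷ mono⇒realizable mono

    mono⇒value : ∀ {b ρs} → All (Mono b) ρs → All (λ ρ → value G ρ ≡ b) ρs
    mono⇒value {ρs = []}          []         = []
    mono⇒value {ρs = orbit _ ∷ _} (Gk ∷ mono) = Gk ∷ mono⇒value mono

    forbidden-mono : ∀ s → r + d ≡ s → Transfers s (_≡ r) (λ c → (c ≢ 0) × (c ≢ s)) → Forbidden
    forbidden-mono s rd≡s poly {b} (selection ρs length≡ weight≡ bounded mono) =
      constant b mono (transfer (_≡ r) (λ c → (c ≢ 0) × (c ≢ s)) poly ρs length≡s (mono⇒realizable mono) (tiling-exact ρs r bounded weight≡))
      where
      length≡s = trans length≡ rd≡s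
      constant : ∀ b → All (Mono b) ρs → ¬ ((valueCount G ρs ≢ 0) × (valueCount G ρs ≢ s))
      constant true  mono (_ , ≢s) = ≢s (trans (valueCount-true G ρs (mono⇒value mono)) length≡s)
      constant false mono (≢0 , _) = ≢0 (valueCount-false G ρs (mono⇒value mono))

    threshold-r/s : ∀ s → r + d ≡ s → Transfers s (_≡ r) (λ c → (c ≢ 0) × (c ≢ s)) → ParityCondition → Threshold r s
    threshold-r/s s rd≡s poly parity k =
      subst (λ S → S * k < 2 * r * (p * p) → (S * k < r * (p * p) → G k ≡ G 0) × (r * (p * p) < S * k → G k ≡ not (G 0)))
            rd≡s (threshold (forbidden-mono s rd≡s poly) parity k)

r≤2r : ∀ r → r ≤ 2 * r
r≤2r r = m≤m+n r (r + 0)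

module Cases (q s : ℕ) (t : (Fin (suc (q * s) * suc (q * s)) → Bool) → Bool) (cyclic : DoublyCyclic (suc (q * s)) t)
  (isPrime : Prime (suc (q * s))) where
  open Transposed (q * s) t cyclic

  instance
    q≢0 : NonZero q
    q≢0 = >-nonZero (prime⇒1≤q q s isPrime)

  s≤n : s ≤ p * p
  s≤n = ≤-trans (≤-trans (m≤n*m s q) (n≤1+n (q * s))) (m≤m*n p p)

  module _ (r₀ : ℕ) (selfDual : SelfDual t) (r≤s : 2 + r₀ ≤ s) where
    private
      square = odd-prime-square (q * s) isPrime (≤-trans (≤-trans (s≤s (s≤s z≤n)) r≤s) (m≤n*m s q))
    open OddSquare (proj₁ square) (proj₂ square) r₀ selfDual

    r≤n : r ≤ p * p
    r≤n = ≤-trans r≤s s≤n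

    2r≡r+r : 2 * r ≡ r + r
    2r≡r+r = cong (r +_) (+-identityʳ r)

    case₁ : 2 * r < s → Transfers s (_≡ r) (_≤ 2 * r ∸ 1) → Threshold 1 2
    case₁ 2r<s poly = threshold-½ (dichotomy (Padded.upperFree forbidden r≤n) (Padded.lowerFree forbidden r≤n))
      where
      forbidden = forbidden-padded s (subst (_< s) 2r≡r+r 2r<s) poly

    case₂ : 2 * r ≡ s → Transfers s (_≤ r) (_≤ 2 * r ∸ 1) → Threshold 1 2
    case₂ 2r≡s poly = threshold-½ (dichotomy (Padded.upperFree forbidden r≤n) (Padded.lowerFree forbidden r≤n))
      where
      forbidden = forbidden-slack s (trans (sym 2r≡r+r) 2r≡s) poly

    case₃ : 2 * r ≡ s → 2 ∣ r → Transfers s (_≡ r) (_≤ 2 * r ∸ 1) → Threshold 1 2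
    case₃ 2r≡s 2∣r poly with half 2∣r
    ... | h , r≡ = threshold-½ (dichotomy (Exact.upperFree h r≡ forbidden) (Exact.lowerFree h r≡ forbidden))
      where
      forbidden = forbidden-exact s (trans (sym 2r≡r+r) 2r≡s) poly

  -- p² = 1 + s w, and the central weight is m = r w
  centre : ∀ r → 0 < r → 2 * r ≤ s → Σ[ m₁ ∈ ℕ ] (r * (p * p) ≡ s * suc m₁ + r) × (suc m₁ + suc (suc m₁) ≤ p * p)
  centre r 0<r 2r≤s = m₁ , rn≡ , 2m+1≤n
    where
    w = q * (2 + q * s)
    1≤rw : 1 ≤ r * w
    1≤rw = *-mono-≤ 0<r (*-mono-≤ (prime⇒1≤q q s isPrime) (s≤s z≤n))
    m₁ = r * w ∸ 1
    m≡rw : suc m₁ ≡ r * w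
    m≡rw = m+[n∸m]≡n 1≤rw
    n≡ : p * p ≡ suc (s * w)
    n≡ = square q s
      where
      square : ∀ q s → suc (q * s) * suc (q * s) ≡ suc (s * (q * (2 + q * s)))
      square = solve-∀
    rn≡ : r * (p * p) ≡ s * suc m₁ + r
    rn≡ = begin-equality
      r * (p * p)       ≡⟨ cong (r *_) n≡ ⟩
      r * suc (s * w)   ≡⟨ regroup r s w ⟩
      s * (r * w) + r   ≡⟨ cong (λ M → s * M + r) (sym m≡rw) ⟩
      s * suc m₁ + r    ∎
      where
      open ≤-Reasoning
      regroup : ∀ r s w → r * suc (s * w) ≡ s * (r * w) + r
      regroup = solve-∀
    2m+1≤n : suc m₁ + suc (suc m₁) ≤ p * p
    2m+1≤n = begin
      suc m₁ + suc (suc m₁)   ≡⟨ +-suc (suc m₁) (suc m₁) ⟩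
      suc (suc m₁ + suc m₁)   ≡⟨ cong (λ M → suc (M + M)) m≡rw ⟩
      suc (r * w + r * w)     ≡⟨ cong suc (*-distribʳ-+ w r r) ⟨
      suc ((r + r) * w)       ≤⟨ s≤s (*-monoˡ-≤ w (subst (_≤ s) (cong (r +_) (+-identityʳ r)) 2r≤s)) ⟩
      suc (s * w)             ≡⟨ n≡ ⟨
      p * p                   ∎
      where open ≤-Reasoning

  parities : ∀ r → 0 < r → r + (s ∸ r) ≡ s → (2 ∣ r) ⊎ ¬ (2 ∣ s) →
    (Σ[ e ∈ ℕ ] s ∸ r ≡ e + e) ⊎ (Σ[ h ∈ ℕ ] Σ[ e ∈ ℕ ] (r ≡ suc h + suc h) × (s ∸ r ≡ suc (e + e)))
  parities r 0<r r+d≡s r-even⊎s-odd with even-or-odd (s ∸ r)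
  ... | inj₁ d-even   = inj₁ d-even
  ... | inj₂ (e , d≡) = inj₂ (proj₁ r-half , e , proj₂ r-half , d≡)
    where
    positive-half : (Σ[ h ∈ ℕ ] r ≡ h + h) → Σ[ h₁ ∈ ℕ ] r ≡ suc h₁ + suc h₁
    positive-half (zero   , r≡0) = ⊥-elim (<⇒≢ 0<r (sym r≡0))
    positive-half (suc h₁ , r≡)  = h₁ , r≡
    r-even : (2 ∣ r) ⊎ ¬ (2 ∣ s) → Σ[ h ∈ ℕ ] r ≡ h + h
    r-even (inj₁ 2∣r) = half 2∣r
    r-even (inj₂ s-odd) with even-or-odd r
    ... | inj₁ r-even   = r-even
    ... | inj₂ (f , r≡) = ⊥-elim (s-odd (divides (suc (f + e)) (trans (sym r+d≡s) (trans (cong₂ _+_ r≡ d≡) (odd+odd f e)))))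
      where
      odd+odd : ∀ f e → suc (f + f) + suc (e + e) ≡ suc (f + e) * 2
      odd+odd = solve-∀
    r-half = positive-half (r-even r-even⊎s-odd)

  case₄ : ∀ r → 0 < r → CaseCond case4 r s → Transfers s (_≡ r) (λ c → (c ≢ 0) × (c ≢ s)) → Threshold r s
  case₄ r 0<r (r<s , 2<s , 2r≤s , r-even⊎s-odd) poly with centre r 0<r 2r≤s
  ... | m₁ , rn≡ , 2m+1≤n = threshold-r/s s r+d≡s poly (parities r 0<r r+d≡s r-even⊎s-odd)
    where
    d = s ∸ r
    r+d≡s : r + d ≡ s
    r+d≡s = m+[n∸m]≡n (<⇒≤ r<s)
    r+r≤r+d : r + r ≤ r + d
    r+r≤r+d = subst₂ _≤_ (cong (r +_) (+-identityʳ r)) (sym r+d≡s) 2r≤s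
    r≤d : r ≤ d
    r≤d = +-cancelˡ-≤ r r d r+r≤r+d
    2≤d : 2 ≤ d
    2≤d = ≮⇒≥ λ d<2 → <⇒≱ 2<s (begin
      s      ≡⟨ r+d≡s ⟨
      r + d  ≤⟨ +-mono-≤ (+-cancelˡ-≤ r r 1 (≤-trans r+r≤r+d (+-monoʳ-≤ r (≤-pred d<2)))) (≤-pred d<2) ⟩
      2      ∎)
      where open ≤-Reasoning
    open Case4Tiling r d m₁ 0<r r≤d 2≤d (trans rn≡ (cong (λ S → S * suc m₁ + r) (sym r+d≡s))) 2m+1≤n

lemma23 : (c : Case) (r s : ℕ) → 0 < r → 0 < s → CaseCond c r s →
  (p : ℕ) → Prime p → (∃ λ q → p ≡ 1 + q * s) →
  (t : (Fin (p * p) → Bool) → Bool) →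
  IsPolymorphism c r s (p * p) t → DoublyCyclic p t →
  (k : ℕ) → θden c s * k < 2 * θnum c r * (p * p) →
    ((θden c s * k < θnum c r * (p * p)) →
        transpose p t ⟨ k ⟩ ≡ transpose p t ⟨ 0 ⟩)
    × ((θden c s * k > θnum c r * (p * p)) →
        transpose p t ⟨ k ⟩ ≡ not (transpose p t ⟨ 0 ⟩))
lemma23 case1 r s _ _ (s≤s (s≤s {n = r₀} z≤n) , 2r<s) _ isPrime (q , refl) t (poly , selfDual) cyclic =
  Cases.case₁ q s t cyclic isPrime r₀ (selfDual tt) (≤-trans (r≤2r r) (<⇒≤ 2r<s)) 2r<s poly
lemma23 case2 r s _ _ (_ , s≤s (s≤s {n = r₀} z≤n) , 2r≡s) _ isPrime (q , refl) t (poly , selfDual) cyclic =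
  Cases.case₂ q s t cyclic isPrime r₀ (selfDual tt) (subst (r ≤_) 2r≡s (r≤2r r)) 2r≡s poly
lemma23 case3 r s _ _ (_ , s≤s (s≤s {n = r₀} z≤n) , 2r≡s , 2∣r) _ isPrime (q , refl) t (poly , selfDual) cyclic =
  Cases.case₃ q s t cyclic isPrime r₀ (selfDual tt) (subst (r ≤_) 2r≡s (r≤2r r)) 2r≡s 2∣r poly
lemma23 case4 r s 0<r _ cond _ isPrime (q , refl) t (poly , _) cyclic =
  Cases.case₄ q s t cyclic isPrime r 0<r cond poly
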